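{- For even $n\ge 6$, $S(C_1^{ -1})=2+F_{n-2}$ and $S(C_3^{ -1})=2-F_{n-2}$; for odd $n\ge 7$, $S(C_2^{ -1})=2+F_{n-2}$ and $S(C_4^{ -1})=2-F_{n-2}$, where $C_1,C_2,C_3,C_4$ are the matrices defined in the context.
   Context: $F_m$ is the $m$-th Fibonacci number, $F_1=F_2=1$, $F_{m+1}=F_m+F_{m-1}$. $S(X)$ is the sum of all entries of a matrix $X$. $e^1,\dots,e^{n-1}$ are the standard basis vectors of $\mathbb{R}^{n-1}$; matrices are given by their columns. For even $n$: $C_1$ is $(n-1)\times(n-1)$ with $C_1e^1=e^1$, $C_1e^2=e^2$; for odd $k$, $3\le k\le n-3$, $C_1e^k=e^1+\sum_{i=1}^{(k-1)/2}e^{2i}+e^k$; for even $k$, $4\le k\le n-2$, $C_1e^k=\sum_{i=1}^{(k-2)/2}e^{2i+1}+e^k$; $C_1e^{n-1}=\sum_{i=1}^{(n-4)/2}e^{2i+1}+e^{n-1}$. $C_3$ is $(n-1)\times(n-1)$ with $C_3e^1=e^1$, $C_3e^2=e^2$; for odd $k$, $3\le k\le n-3$, $C_3e^k=e^1+\sum_{i=1}^{(k-1)/2}e^{2i}+e^k$; for even $k$, $4\le k\le n-4$, $C_3e^k=\sum_{i=1}^{(k-2)/2}e^{2i+1}+e^k$; $C_3e^{n-2}=e^1+\sum_{i=1}^{(n-4)/2}e^{2i}+e^{n-2}$, $C_3e^{n-1}=e^1+\sum_{i=1}^{(n-4)/2}e^{2i}+e^{n-1}$. For odd $n$: $C_2$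 is $(n-1)\times(n-1)$ with $C_2e^1=e^1$, $C_2e^2=e^2$; for odd $k$, $3\le k\le n-4$, $C_2e^k=e^1+\sum_{i=1}^{(k-1)/2}e^{2i}+e^k$; for even $k$, $4\le k\le n-3$, $C_2e^k=\sum_{i=1}^{(k-2)/2}e^{2i+1}+e^k$; $C_2e^{n-2}=\sum_{i=1}^{(n-5)/2}e^{2i+1}+e^{n-2}$, $C_2e^{n-1}=\sum_{i=1}^{(n-5)/2}e^{2i+1}+e^{n-1}$. $C_4$ is $(n-1)\times(n-1)$ with $C_4e^1=e^1$, $C_4e^2=e^2$; for odd $k$, $3\le k\le n-2$, $C_4e^k=e^1+\sum_{i=1}^{(k-1)/2}e^{2i}+e^k$; for even $k$, $4\le k\le n-3$, $C_4e^k=\sum_{i=1}^{(k-2)/2}e^{2i+1}+e^k$; $C_4e^{n-1}=e^1+\sum_{i=1}^{(n-3)/2}e^{2i}+e^{n-1}$. -}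

module Defs where

open import Data.Nat using (ℕ; zero; suc; _∸_; _%_; _≡ᵇ_; _≤ᵇ_)
open import Data.Bool using (Bool; true; false; if_then_else_; _∧_; _∨_)
open import Data.Integer using (ℤ; +_; _+_; _*_)
open import Data.Fin using (Fin; toℕ) renaming (zero to fzero; suc to fsuc)
open import Data.Product using (_×_)
open import Relation.Binary.PropositionalEquality using (_≡_)

-- Fibonacci numbers: fib 0 = 0, fib 1 = 1, so fib m = F_m with F_1 = F_2 = 1.
fib : ℕ → ℕ
fib zero = zero
fib (suc zero) = suc zero
fib (suc (suc m)) = fib (suc m) Data.Nat.+ fib m

Mat : ℕ → Set
Mat m = Fin m → Fin m → ℤ

sumFin : (m : ℕ) → (Fin m → ℤ) → ℤ
sumFin zero f = + 0
sumFin (suc m) f = f fzero + sumFin m (λ i → f (fsuc i))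

_⊗_ : {m : ℕ} → Mat m → Mat m → Mat m
_⊗_ {m} A B i j = sumFin m (λ l → A i l * B l j)

I : {m : ℕ} → Mat m
I i j = if toℕ i ≡ᵇ toℕ j then + 1 else + 0

S : {m : ℕ} → Mat m → ℤ
S {m} X = sumFin m (λ i → sumFin m (λ j → X i j))

IsInverse : {m : ℕ} → Mat m → Mat m → Set
IsInverse A B = (∀ i j → (A ⊗ B) i j ≡ I i j) × (∀ i j → (B ⊗ A) i j ≡ I i j)

-- Boolean helpers on 1-based indices
isEven : ℕ → Bool
isEven k = k % 2 ≡ᵇ 0

evenIn : ℕ → ℕ → ℕ → Bool
evenIn i a b = isEven i ∧ (a ≤ᵇ i) ∧ (i ≤ᵇ b)

oddIn : ℕ → ℕ → ℕ → Bool
oddIn i a b = (i % 2 ≡ᵇ 1) ∧ (a ≤ᵇ i) ∧ (i ≤ᵇ b)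

-- column pattern for odd k: e^1 + Σ_{j=1}^{(k-1)/2} e^{2j} + e^k  (row i, 1-based)
colOdd : ℕ → ℕ → Bool
colOdd k i = (i ≡ᵇ 1) ∨ evenIn i 2 (k ∸ 1) ∨ (i ≡ᵇ k)

-- column pattern for even k: Σ_{j=1}^{(k-2)/2} e^{2j+1} + e^k
colEven : ℕ → ℕ → Bool
colEven k i = oddIn i 3 (k ∸ 1) ∨ (i ≡ᵇ k)

colGen : ℕ → ℕ → Bool
colGen k i =
  if k ≡ᵇ 1 then i ≡ᵇ 1 else
  if k ≡ᵇ 2 then i ≡ᵇ 2 else
  if isEven k then colEven k i else colOdd k i

b2z : Bool → ℤ
b2z b = if b then + 1 else + 0

-- 1-based entries (row i, column k) of C₁ … C₄ of size (n-1)
c1 : ℕ → ℕ → ℕ → Bool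
c1 n i k = if k ≡ᵇ (n ∸ 1) then oddIn i 3 (n ∸ 3) ∨ (i ≡ᵇ k) else colGen k i

c3 : ℕ → ℕ → ℕ → Bool
c3 n i k =
  if k ≡ᵇ (n ∸ 2) then (i ≡ᵇ 1) ∨ evenIn i 2 (n ∸ 4) ∨ (i ≡ᵇ k) else
  if k ≡ᵇ (n ∸ 1) then (i ≡ᵇ 1) ∨ evenIn i 2 (n ∸ 4) ∨ (i ≡ᵇ k) else
  colGen k i

c2 : ℕ → ℕ → ℕ → Bool
c2 n i k =
  if k ≡ᵇ (n ∸ 2) then oddIn i 3 (n ∸ 4) ∨ (i ≡ᵇ k) else
  if k ≡ᵇ (n ∸ 1) then oddIn i 3 (n ∸ 4) ∨ (i ≡ᵇ k) else
  colGen k i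

c4 : ℕ → ℕ → ℕ → Bool
c4 n i k = if k ≡ᵇ (n ∸ 1) then (i ≡ᵇ 1) ∨ evenIn i 2 (n ∸ 3) ∨ (i ≡ᵇ k) else colGen k i

toMat : (n : ℕ) → (ℕ → ℕ → ℕ → Bool) → Mat (n ∸ 1)
toMat n c i k = b2z (c n (suc (toℕ i)) (suc (toℕ k)))

C₁ C₂ C₃ C₄ : (n : ℕ) → Mat (n ∸ 1)
C₁ n = toMat n c1
C₂ n = toMat n c2
C₃ n = toMat n c3
C₄ n = toMat n c4

module Submission where

-- All four matrices share the generic columns of a matrix G (row 1 marks the odd columns,
-- row p ≥ 2 the diagonal and the columns at odd distance to its right); C₁ and C₄ change
-- the last column, C₂ and C₃ the last two.  Subtracting row 2 from row 1 and row p + 2 from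
-- row p ≥ 2 is left multiplication by a banded matrix W with Toeplitz inverse V, and turns
-- G into the banded matrix T with rows e₁ - e₂ and e_p + e_{p+1} - e_{p+2}, whose inverse X
-- is Toeplitz with signed Fibonacci entries (the series of 1/(1 + z - z²)).  The special
-- columns reduce to unit columns, sheared for C₂ and C₃, and this column surgery preserves
-- inverse pairs; hence C⁻¹ = X′ W for the correspondingly modified X′.  Only the last two
-- rows of W have nonzero row sums, so S(C⁻¹) is the sum of the last two column sums of X′,
-- which are 1 and 1 ± F_{n-2}.
--
-- Matrices are functions ℕ → ℕ → ℤ, 1-based as in the paper, whose N × N block is the
-- matrix.

open import Defs
open import Data.Nat using (ℕ; zero; suc; _≤_; _<_; _∸_; _%_; _≡ᵇ_; _≤ᵇ_; z≤n; s≤s)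
import Data.Nat.Properties as ℕP
open import Data.Integer using (ℤ; +_; -_; _+_; _-_; _*_)
open import Data.Integer.Properties
  using (+-*-semiring; *-identityˡ; *-identityʳ; +-identityˡ; +-identityʳ; *-zeroʳ; *-comm; *-assoc;
         -1*i≡-i; +-inverseʳ; pos-+; neg-involutive)
open import Data.Integer.Tactic.RingSolver using (solve-∀)
open import Algebra.Properties.Semiring.Sum +-*-semiring using (sum; ∑-distrib-+; ∑-comm; *-distribˡ-sum; sum-replicate-zero)
open import Data.Bool using (Bool; true; false; not; if_then_else_; _∧_; _∨_; _xor_)
import Data.Bool as 𝔹
open import Data.Bool.Properties using (T-≡; ∨-zeroʳ; not-involutive)
open import Data.Fin using (Fin; toℕ)
open import Data.Fin.Properties using (toℕ<n)
open import Data.Product using (Σ; _×_; _,_; proj₁; proj₂)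
open import Data.Sum using (inj₁; inj₂)
open import Data.Empty using (⊥-elim)
open import Function.Bundles using (Equivalence)
open import Relation.Nullary using (Dec; yes; no; ¬_)
open import Relation.Binary.Bundles using (Setoid)
open import Relation.Binary.Definitions using (tri<; tri≈; tri>)
open import Relation.Binary.PropositionalEquality

≤ᵇ-true : ∀ {m n} → m ≤ n → (m ≤ᵇ n) ≡ true
≤ᵇ-true m≤n = Equivalence.to T-≡ (ℕP.≤⇒≤ᵇ m≤n)

≤ᵇ-false : ∀ {m n} → n < m → (m ≤ᵇ n) ≡ false
≤ᵇ-false {m} {n} n<m with m ≤ᵇ n in eq
... | false = refl
... | true  = ⊥-elim (ℕP.<⇒≱ n<m (ℕP.≤ᵇ⇒≤ m n (subst 𝔹.T (sym eq) _)))

≡ᵇ-true : ∀ {m n} → m ≡ n → (m ≡ᵇ n) ≡ true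
≡ᵇ-true {m} m≡n = Equivalence.to T-≡ (ℕP.≡⇒≡ᵇ m _ m≡n)

≡ᵇ-false : ∀ {m n} → m ≢ n → (m ≡ᵇ n) ≡ false
≡ᵇ-false {m} {n} m≢n with m ≡ᵇ n in eq
... | false = refl
... | true  = ⊥-elim (m≢n (ℕP.≡ᵇ⇒≡ m n (subst 𝔹.T (sym eq) _)))

-- ∑ N f = f 1 + ⋯ + f N.  It is defined by recursion rather than as the library's sum
-- over Fin N, so that f can be recovered from ∑ N f by unification.
∑ : ℕ → (ℕ → ℤ) → ℤ
∑ zero    f = + 0
∑ (suc N) f = f 1 + ∑ N (λ p → f (suc p))

-- ∑ is the library sum over Fin N, which gives us its algebraic laws
∑-as-sum : ∀ N (f : ℕ → ℤ) → ∑ N f ≡ sum {N} (λ i → f (suc (toℕ i)))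
∑-as-sum zero    f = refl
∑-as-sum (suc N) f = cong (_+_ (f 1)) (∑-as-sum N (λ p → f (suc p)))

∑-cong : ∀ N {f g : ℕ → ℤ} → (∀ i → i < N → f (suc i) ≡ g (suc i)) → ∑ N f ≡ ∑ N g
∑-cong zero    f≗g = refl
∑-cong (suc N) f≗g = cong₂ _+_ (f≗g 0 (s≤s z≤n)) (∑-cong N (λ i i<N → f≗g (suc i) (s≤s i<N)))

∑-ext : ∀ N {f g : ℕ → ℤ} → (∀ p → f p ≡ g p) → ∑ N f ≡ ∑ N g
∑-ext N f≗g = ∑-cong N (λ i _ → f≗g (suc i))

∑-+ : ∀ N (f g : ℕ → ℤ) → ∑ N (λ p → f p + g p) ≡ ∑ N f + ∑ N g
∑-+ N f g = begin
  ∑ N (λ p → f p + g p)                                             ≡⟨ ∑-as-sum N _ ⟩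
  sum {N} (λ i → f (suc (toℕ i)) + g (suc (toℕ i)))                 ≡⟨ ∑-distrib-+ {N} (λ i → f (suc (toℕ i))) _ ⟩
  sum {N} (λ i → f (suc (toℕ i))) + sum {N} (λ i → g (suc (toℕ i))) ≡⟨ sym (cong₂ _+_ (∑-as-sum N f) (∑-as-sum N g)) ⟩
  ∑ N f + ∑ N g                                                     ∎
  where open ≡-Reasoning

∑-*ˡ : ∀ N c (f : ℕ → ℤ) → ∑ N (λ p → c * f p) ≡ c * ∑ N f
∑-*ˡ N c f = begin
  ∑ N (λ p → c * f p)                 ≡⟨ ∑-as-sum N _ ⟩
  sum {N} (λ i → c * f (suc (toℕ i))) ≡⟨ sym (*-distribˡ-sum {N} c (λ i → f (suc (toℕ i)))) ⟩
  c * sum {N} (λ i → f (suc (toℕ i))) ≡⟨ cong (c *_) (sym (∑-as-sum N f)) ⟩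
  c * ∑ N f                           ∎
  where open ≡-Reasoning

∑-*ʳ : ∀ N c (f : ℕ → ℤ) → ∑ N (λ p → f p * c) ≡ ∑ N f * c
∑-*ʳ N c f = trans (∑-ext N (λ p → *-comm (f p) c)) (trans (∑-*ˡ N c f) (*-comm c (∑ N f)))

∑-- : ∀ N (f g : ℕ → ℤ) → ∑ N (λ p → f p - g p) ≡ ∑ N f - ∑ N g
∑-- N f g = begin
  ∑ N (λ p → f p - g p)            ≡⟨ ∑-ext N (λ p → cong (_+_ (f p)) (sym (-1*i≡-i (g p)))) ⟩
  ∑ N (λ p → f p + - + 1 * g p)    ≡⟨ ∑-+ N f _ ⟩
  ∑ N f + ∑ N (λ p → - + 1 * g p)  ≡⟨ cong (_+_ (∑ N f)) (trans (∑-*ˡ N (- + 1) g) (-1*i≡-i (∑ N g))) ⟩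
  ∑ N f - ∑ N g                    ∎
  where open ≡-Reasoning

∑-swap : ∀ N M (f : ℕ → ℕ → ℤ) → ∑ N (λ p → ∑ M (f p)) ≡ ∑ M (λ q → ∑ N (λ p → f p q))
∑-swap N M f = begin
  ∑ N (λ p → ∑ M (f p))
    ≡⟨ trans (∑-ext N (λ p → ∑-as-sum M (f p))) (∑-as-sum N (λ p → sum {M} (λ j → f p (suc (toℕ j))))) ⟩
  sum {N} (λ i → sum {M} (λ j → f (suc (toℕ i)) (suc (toℕ j))))
    ≡⟨ ∑-comm {N} {M} (λ i j → f (suc (toℕ i)) (suc (toℕ j))) ⟩
  sum {M} (λ j → sum {N} (λ i → f (suc (toℕ i)) (suc (toℕ j))))
    ≡⟨ sym (trans (∑-ext M (λ q → ∑-as-sum N (λ p → f p q))) (∑-as-sum M (λ q → sum {N} (λ i → f (suc (toℕ i)) q)))) ⟩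
  ∑ M (λ q → ∑ N (λ p → f p q)) ∎
  where open ≡-Reasoning

∑-zero : ∀ N {f : ℕ → ℤ} → (∀ i → i < N → f (suc i) ≡ + 0) → ∑ N f ≡ + 0
∑-zero N f≗0 = trans (∑-cong N {g = λ _ → + 0} f≗0) (trans (∑-as-sum N _) (sum-replicate-zero N))

∑-trunc : ∀ A B (f : ℕ → ℤ) → A ≤ B → (∀ p → A < p → f p ≡ + 0) → ∑ B f ≡ ∑ A f
∑-trunc zero B f _ f≗0 = ∑-zero B (λ i _ → f≗0 (suc i) (s≤s z≤n))
∑-trunc (suc A) (suc B) f (s≤s A≤B) f≗0 =
  cong (_+_ (f 1)) (∑-trunc A B (λ p → f (suc p)) A≤B (λ p A<p → f≗0 (suc p) (s≤s A<p)))

∑-bilinear : ∀ N (f g u v : ℕ → ℤ) (x y : ℤ) →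
  ∑ N (λ l → (f l + x * g l) * (u l + y * v l)) ≡
  ∑ N (λ l → f l * u l) + y * ∑ N (λ l → f l * v l) + x * ∑ N (λ l → g l * u l) + x * y * ∑ N (λ l → g l * v l)
∑-bilinear N f g u v x y = begin
  ∑ N (λ l → (f l + x * g l) * (u l + y * v l))
    ≡⟨ ∑-ext N (λ l → expand x y (f l) (g l) (u l) (v l)) ⟩
  ∑ N (λ l → f l * u l + y * (f l * v l) + x * (g l * u l) + x * y * (g l * v l))
    ≡⟨ trans (∑-+ N _ _) (cong (_+ _) (trans (∑-+ N _ _) (cong (_+ _) (∑-+ N _ _)))) ⟩
  ∑ N (λ l → f l * u l) + ∑ N (λ l → y * (f l * v l)) + ∑ N (λ l → x * (g l * u l)) + ∑ N (λ l → x * y * (g l * v l))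
    ≡⟨ cong₂ _+_ (cong₂ _+_ (cong (_+_ (∑ N (λ l → f l * u l))) (∑-*ˡ N y _)) (∑-*ˡ N x _)) (∑-*ˡ N (x * y) _) ⟩
  ∑ N (λ l → f l * u l) + y * ∑ N (λ l → f l * v l) + x * ∑ N (λ l → g l * u l) + x * y * ∑ N (λ l → g l * v l) ∎
  where
  open ≡-Reasoning
  expand : ∀ x y a b c d → (a + x * b) * (c + y * d) ≡ a * c + y * (a * d) + x * (b * c) + x * y * (b * d)
  expand = solve-∀

δ : ℕ → ℕ → ℤ
δ p q = b2z (p ≡ᵇ q)

δ-sym : ∀ p q → δ p q ≡ δ q p
δ-sym zero    zero    = refl
δ-sym zero    (suc q) = refl
δ-sym (suc p) zero    = refl
δ-sym (suc p) (suc q) = δ-sym p q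

δ-off : ∀ {p q} → p ≢ q → δ p q ≡ + 0
δ-off p≢q = cong b2z (≡ᵇ-false p≢q)

sift : ∀ N k (f : ℕ → ℤ) → (N ≤ k → f (suc k) ≡ + 0) → ∑ N (λ l → δ (suc k) l * f l) ≡ f (suc k)
sift zero    k       f vanish = sym (vanish z≤n)
sift (suc N) zero    f vanish = begin
  + 1 * f 1 + ∑ N (λ p → δ 1 (suc p) * f (suc p)) ≡⟨ cong₂ _+_ (*-identityˡ (f 1)) (∑-zero N (λ _ _ → refl)) ⟩
  f 1 + + 0                                       ≡⟨ +-identityʳ (f 1) ⟩
  f 1                                              ∎
  where open ≡-Reasoning
sift (suc N) (suc k) f vanish =
  trans (+-identityˡ _) (sift N k (λ p → f (suc p)) (λ N≤k → vanish (s≤s N≤k)))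

sift-in : ∀ N k (f : ℕ → ℤ) → k < N → ∑ N (λ l → δ (suc k) l * f l) ≡ f (suc k)
sift-in N k f k<N = sift N k f (λ N≤k → ⊥-elim (ℕP.<⇒≱ k<N N≤k))

sift-col : ∀ N k (f : ℕ → ℤ) → k < N → ∑ N (λ l → f l * δ l (suc k)) ≡ f (suc k)
sift-col N k f k<N =
  trans (∑-ext N (λ l → trans (*-comm (f l) _) (cong (_* f l) (δ-sym l (suc k))))) (sift-in N k f k<N)

sift₃ : ∀ N (y z : ℤ) {i j k} (f : ℕ → ℤ) →
  ∑ N (λ l → δ i l * f l) ≡ f i → ∑ N (λ l → δ j l * f l) ≡ f j → ∑ N (λ l → δ k l * f l) ≡ f k →
  ∑ N (λ l → (δ i l + y * δ j l + z * δ k l) * f l) ≡ f i + y * f j + z * f k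
sift₃ N y z {i} {j} {k} f sᵢ sⱼ sₖ = begin
  ∑ N (λ l → (δ i l + y * δ j l + z * δ k l) * f l)
    ≡⟨ ∑-ext N (λ l → distrib y z (δ i l) (δ j l) (δ k l) (f l)) ⟩
  ∑ N (λ l → δ i l * f l + y * (δ j l * f l) + z * (δ k l * f l))
    ≡⟨ trans (∑-+ N _ _) (cong (_+ _) (∑-+ N _ _)) ⟩
  ∑ N (λ l → δ i l * f l) + ∑ N (λ l → y * (δ j l * f l)) + ∑ N (λ l → z * (δ k l * f l))
    ≡⟨ cong₂ _+_ (cong₂ _+_ sᵢ (trans (∑-*ˡ N y _) (cong (y *_) sⱼ))) (trans (∑-*ˡ N z _) (cong (z *_) sₖ)) ⟩
  f i + y * f j + z * f k ∎
  where
  open ≡-Reasoning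
  distrib : ∀ y z a b c d → (a + y * b + z * c) * d ≡ a * d + y * (b * d) + z * (c * d)
  distrib = solve-∀

-- ℕ-indexed matrices; as an N × N matrix only the entries in [1, N]² matter
Matℕ : Set
Matℕ = ℕ → ℕ → ℤ

mul : ℕ → Matℕ → Matℕ → Matℕ
mul N P Q p q = ∑ N (λ l → P p l * Q l q)

infix 4 _≈[_]_
record _≈[_]_ (P : Matℕ) (N : ℕ) (Q : Matℕ) : Set where
  constructor agree
  field entry : ∀ i j → i < N → j < N → P (suc i) (suc j) ≡ Q (suc i) (suc j)
open _≈[_]_ public

≈-refl : ∀ {N P} → P ≈[ N ] P
≈-refl = agree λ _ _ _ _ → refl

≈-sym : ∀ {N P Q} → P ≈[ N ] Q → Q ≈[ N ] P
≈-sym P≈Q = agree λ i j i<N j<N → sym (entry P≈Q i j i<N j<N)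

≈-trans : ∀ {N P Q R} → P ≈[ N ] Q → Q ≈[ N ] R → P ≈[ N ] R
≈-trans P≈Q Q≈R = agree λ i j i<N j<N → trans (entry P≈Q i j i<N j<N) (entry Q≈R i j i<N j<N)

≈-setoid : ℕ → Setoid _ _
≈-setoid N = record
  { Carrier = Matℕ
  ; _≈_ = _≈[ N ]_
  ; isEquivalence = record { refl = ≈-refl ; sym = ≈-sym ; trans = ≈-trans }
  }

mul-assoc : ∀ N P Q R → mul N (mul N P Q) R ≈[ N ] mul N P (mul N Q R)
mul-assoc N P Q R = agree λ i j _ _ → assoc (suc i) (suc j)
  where
  open ≡-Reasoning
  assoc : ∀ p q → mul N (mul N P Q) R p q ≡ mul N P (mul N Q R) p q
  assoc p q = begin
    ∑ N (λ l → ∑ N (λ m → P p m * Q m l) * R l q)   ≡⟨ ∑-ext N (λ l → sym (∑-*ʳ N (R l q) _)) ⟩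
    ∑ N (λ l → ∑ N (λ m → P p m * Q m l * R l q))   ≡⟨ ∑-swap N N _ ⟩
    ∑ N (λ m → ∑ N (λ l → P p m * Q m l * R l q))
      ≡⟨ ∑-ext N (λ m → trans (∑-ext N (λ l → *-assoc (P p m) (Q m l) (R l q))) (∑-*ˡ N (P p m) _)) ⟩
    ∑ N (λ m → P p m * ∑ N (λ l → Q m l * R l q))   ∎

mul-congˡ : ∀ N {P P′} Q → P ≈[ N ] P′ → mul N P Q ≈[ N ] mul N P′ Q
mul-congˡ N Q P≈P′ = agree λ i j i<N _ →
  ∑-cong N (λ l l<N → cong (_* Q (suc l) (suc j)) (entry P≈P′ i l i<N l<N))

mul-congʳ : ∀ N P {Q Q′} → Q ≈[ N ] Q′ → mul N P Q ≈[ N ] mul N P Q′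
mul-congʳ N P Q≈Q′ = agree λ i j _ j<N →
  ∑-cong N (λ l l<N → cong (P (suc i) (suc l) *_) (entry Q≈Q′ l j l<N j<N))

mul-identityˡ : ∀ N Q → mul N δ Q ≈[ N ] Q
mul-identityˡ N Q = agree λ i j i<N _ → sift-in N i (λ l → Q l (suc j)) i<N

inverse-via : ∀ N {A W T X V} → mul N W A ≈[ N ] T → mul N X T ≈[ N ] δ → mul N T X ≈[ N ] δ →
  mul N V W ≈[ N ] δ → mul N (mul N X W) A ≈[ N ] δ × mul N A (mul N X W) ≈[ N ] δ
inverse-via N {A} {W} {T} {X} {V} WA≈T XT≈I TX≈I VW≈I = left , right
  where
  open import Relation.Binary.Reasoning.Setoid (≈-setoid N)
  A≈VT : A ≈[ N ] mul N V T
  A≈VT = begin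
    A                   ≈⟨ mul-identityˡ N A ⟨
    mul N δ A           ≈⟨ mul-congˡ N A VW≈I ⟨
    mul N (mul N V W) A ≈⟨ mul-assoc N V W A ⟩
    mul N V (mul N W A) ≈⟨ mul-congʳ N V WA≈T ⟩
    mul N V T           ∎
  left : mul N (mul N X W) A ≈[ N ] δ
  left = begin
    mul N (mul N X W) A ≈⟨ mul-assoc N X W A ⟩
    mul N X (mul N W A) ≈⟨ mul-congʳ N X WA≈T ⟩
    mul N X T           ≈⟨ XT≈I ⟩
    δ                   ∎
  right : mul N A (mul N X W) ≈[ N ] δ
  right = begin
    mul N A (mul N X W)           ≈⟨ mul-congˡ N (mul N X W) A≈VT ⟩
    mul N (mul N V T) (mul N X W) ≈⟨ mul-assoc N V T (mul N X W) ⟩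
    mul N V (mul N T (mul N X W)) ≈⟨ mul-congʳ N V (mul-assoc N T X W) ⟨
    mul N V (mul N (mul N T X) W) ≈⟨ mul-congʳ N V (mul-congˡ N W TX≈I) ⟩
    mul N V (mul N δ W)           ≈⟨ mul-congʳ N V (mul-identityˡ N W) ⟩
    mul N V W                     ≈⟨ VW≈I ⟩
    δ                             ∎

mul-sparseˡ : ∀ N (P Q : Matℕ) p q (y z : ℤ) i j k →
  (N ≤ i → Q (suc i) q ≡ + 0) → (N ≤ j → Q (suc j) q ≡ + 0) → (N ≤ k → Q (suc k) q ≡ + 0) →
  (∀ l → P p l ≡ δ (suc i) l + y * δ (suc j) l + z * δ (suc k) l) →
  mul N P Q p q ≡ Q (suc i) q + y * Q (suc j) q + z * Q (suc k) q
mul-sparseˡ N P Q p q y z i j k vᵢ vⱼ vₖ row =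
  trans (∑-ext N (λ l → cong (_* Q l q) (row l)))
        (sift₃ N y z (λ l → Q l q) (sift N i _ vᵢ) (sift N j _ vⱼ) (sift N k _ vₖ))

mul-sparseʳ : ∀ N (P Q : Matℕ) p q (y z : ℤ) i j k →
  (N ≤ i → P p (suc i) ≡ + 0) → (N ≤ j → P p (suc j) ≡ + 0) → (N ≤ k → P p (suc k) ≡ + 0) →
  (∀ l → Q l q ≡ δ (suc i) l + y * δ (suc j) l + z * δ (suc k) l) →
  mul N P Q p q ≡ P p (suc i) + y * P p (suc j) + z * P p (suc k)
mul-sparseʳ N P Q p q y z i j k vᵢ vⱼ vₖ col =
  trans (∑-ext N (λ l → trans (*-comm (P p l) (Q l q)) (cong (_* P p l) (col l))))
        (sift₃ N y z (P p) (sift N i _ vᵢ) (sift N j _ vⱼ) (sift N k _ vₖ))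

-- the upper-triangular Toeplitz matrix with top row f: toe f p q = f (q ∸ p) for p ≤ q
toe : (ℕ → ℤ) → Matℕ
toe f zero    q       = f q
toe f (suc p) zero    = + 0
toe f (suc p) (suc q) = toe f p q

toe-below : ∀ f p q → q < p → toe f p q ≡ + 0
toe-below f (suc p) zero    _         = refl
toe-below f (suc p) (suc q) (s≤s q<p) = toe-below f p q q<p

toe-diag : ∀ f p → toe f p p ≡ f 0
toe-diag f zero    = refl
toe-diag f (suc p) = toe-diag f p

-- The polynomial 1 + a z + b z² and its inverse power series g, determined by
-- g₀ = 1, g₁ = -a and the recurrence g_{d+2} + a g_{d+1} + b g_d = 0.
band : ℤ → ℤ → ℕ → ℤ
band a b 0 = + 1
band a b 1 = a
band a b 2 = b
band a b (suc (suc (suc _))) = + 0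

coband : ℤ → ℤ → ℕ → ℤ
coband a b 0             = + 1
coband a b 1             = - a
coband a b (suc (suc d)) = - (a * coband a b (suc d) + b * coband a b d)

-- The banded matrix with rows e₁ - e₂ and e_p + a e_{p+1} + b e_{p+2} (p ≥ 2), and its
-- inverse, whose rows are e₁ + g⟨2⟩ and g⟨p⟩ (p ≥ 2), g⟨p⟩ being g shifted to start at column p.
banded : ℤ → ℤ → Matℕ
banded a b zero          q = + 0
banded a b (suc zero)    q = δ 1 q - δ 2 q
banded a b (suc (suc p)) q = toe (band a b) (suc (suc p)) q

cobanded : ℤ → ℤ → Matℕ
cobanded a b zero          q = + 0
cobanded a b (suc zero)    q = δ 1 q + toe (coband a b) 2 q
cobanded a b (suc (suc p)) q = toe (coband a b) (suc (suc p)) q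

private
  zero-comb : ∀ a b → + 0 + a * + 0 + b * + 0 ≡ + 0
  zero-comb = solve-∀
  one-comb : ∀ a b → + 1 + a * + 0 + b * + 0 ≡ + 1
  one-comb = solve-∀

module _ (a b : ℤ) where

  private
    g : ℕ → ℤ
    g = coband a b

  toe-band : ∀ p l → toe (band a b) p l ≡ δ p l + a * δ (suc p) l + b * δ (suc (suc p)) l
  toe-band zero    zero                = solve₁ a b
    where solve₁ : ∀ a b → + 1 ≡ + 1 + a * + 0 + b * + 0
          solve₁ = solve-∀
  toe-band zero    (suc zero)          = solve₂ a b
    where solve₂ : ∀ a b → a ≡ + 0 + a * + 1 + b * + 0
          solve₂ = solve-∀
  toe-band zero    (suc (suc zero))    = solve₃ a b
    where solve₃ : ∀ a b → b ≡ + 0 + a * + 0 + b * + 1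
          solve₃ = solve-∀
  toe-band zero    (suc (suc (suc l))) = sym (zero-comb a b)
  toe-band (suc p) zero                = sym (zero-comb a b)
  toe-band (suc p) (suc l)             = toe-band p l

  coband-rec : ∀ d → g (suc (suc d)) + a * g (suc d) + b * g d ≡ + 0
  coband-rec d = cancel (a * g (suc d)) (b * g d)
    where cancel : ∀ u v → - (u + v) + u + v ≡ + 0
          cancel = solve-∀

  toe-coband-row : ∀ p q → toe g p (suc (suc q)) + a * toe g p (suc q) + b * toe g p q ≡ δ p (suc (suc q))
  toe-coband-row zero                q    = coband-rec q
  toe-coband-row (suc zero)          zero = cancel a b
    where cancel : ∀ a b → - a + a * + 1 + b * + 0 ≡ + 0
          cancel = solve-∀
  toe-coband-row (suc (suc zero))    zero = one-comb a b
  toe-coband-row (suc (suc (suc p))) zero = zero-comb a b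
  toe-coband-row (suc p)             (suc q) = toe-coband-row p q

  toe-coband-col : ∀ p q → toe g p q + a * toe g (suc p) q + b * toe g (suc (suc p)) q ≡ δ p q
  toe-coband-col zero    zero                = one-comb a b
  toe-coband-col zero    (suc zero)          = cancel a b
    where cancel : ∀ a b → - a + a * + 1 + b * + 0 ≡ + 0
          cancel = solve-∀
  toe-coband-col zero    (suc (suc q))       = coband-rec q
  toe-coband-col (suc p) zero                = zero-comb a b
  toe-coband-col (suc p) (suc q)             = toe-coband-col p q

  banded-below : ∀ p q → q < p → banded a b p q ≡ + 0
  banded-below (suc zero)    zero    _         = refl
  banded-below (suc zero)    (suc q) (s≤s ())
  banded-below (suc (suc p)) q    q<p = toe-below (band a b) (suc (suc p)) q q<p

  cobanded-below : ∀ p q → q < p → cobanded a b p q ≡ + 0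
  cobanded-below (suc zero)    zero    _         = refl
  cobanded-below (suc zero)    (suc q) (s≤s ())
  cobanded-below (suc (suc p)) q    q<p = toe-below g (suc (suc p)) q q<p

  -- rows: the first row of the product is (e₁ + g⟨2⟩) - g⟨2⟩, the others are toe-coband-col
  banded·cobanded : ∀ N → mul N (banded a b) (cobanded a b) ≈[ N ] δ
  banded·cobanded N = agree entryᵢⱼ
    where
    vanish : ∀ {j} → j < N → ∀ k → N ≤ k → cobanded a b (suc k) (suc j) ≡ + 0
    vanish j<N k N≤k = cobanded-below (suc k) _ (s≤s (ℕP.<-≤-trans j<N N≤k))
    first-row : ∀ u v w → u - v ≡ u + - + 1 * v + + 0 * w
    first-row = solve-∀
    cancel : ∀ d t u → d + t + - + 1 * t + + 0 * u ≡ d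
    cancel = solve-∀
    entryᵢⱼ : ∀ i j → i < N → j < N → mul N (banded a b) (cobanded a b) (suc i) (suc j) ≡ δ (suc i) (suc j)
    entryᵢⱼ zero j _ j<N =
      trans (mul-sparseˡ N (banded a b) (cobanded a b) 1 (suc j) (- + 1) (+ 0) 0 1 2
               (vanish j<N 0) (vanish j<N 1) (vanish j<N 2) (λ l → first-row (δ 1 l) (δ 2 l) (δ 3 l)))
            (cancel (δ 1 (suc j)) (toe g 2 (suc j)) (toe g 3 (suc j)))
    entryᵢⱼ (suc i) j _ j<N =
      trans (mul-sparseˡ N (banded a b) (cobanded a b) (suc (suc i)) (suc j) a b (suc i) (suc (suc i)) (suc (suc (suc i)))
               (vanish j<N _) (vanish j<N _) (vanish j<N _) (toe-band (suc (suc i))))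
            (toe-coband-col (suc (suc i)) (suc j))

  -- columns: column q ≥ 4 of banded a b is e_q + a e_{q-1} + b e_{q-2}, and the
  -- product against it is the recurrence toe-coband-row; columns 1, 2, 3 are checked directly
  cobanded·banded : ∀ N → mul N (cobanded a b) (banded a b) ≈[ N ] δ
  cobanded·banded N = agree entryᵢⱼ
    where
    X L : Matℕ
    X = cobanded a b
    L = banded a b
    never : ∀ {k} {A : Set} → k < N → N ≤ k → A
    never k<N N≤k = ⊥-elim (ℕP.<⇒≱ k<N N≤k)
    col₁ : ∀ l → L l 1 ≡ δ 1 l + + 0 * δ 1 l + + 0 * δ 1 l
    col₁ zero          = refl
    col₁ (suc zero)    = refl
    col₁ (suc (suc l)) = refl
    col₂ : ∀ l → L l 2 ≡ δ 2 l + - + 1 * δ 1 l + + 0 * δ 1 l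
    col₂ zero                = refl
    col₂ (suc zero)          = refl
    col₂ (suc (suc zero))    = refl
    col₂ (suc (suc (suc l))) = refl
    col₃ : ∀ l → L l 3 ≡ δ 3 l + a * δ 2 l + + 0 * δ 1 l
    col₃ zero                      = sym (zero-comb a (+ 0))
    col₃ (suc zero)                = sym (zero-comb a (+ 0))
    col₃ (suc (suc zero))          = solve₁ a
      where solve₁ : ∀ a → a ≡ + 0 + a * + 1 + + 0 * + 0
            solve₁ = solve-∀
    col₃ (suc (suc (suc zero)))    = sym (one-comb a (+ 0))
    col₃ (suc (suc (suc (suc l)))) = sym (zero-comb a (+ 0))
    colₖ : ∀ k l → L l (suc (suc (suc (suc k)))) ≡
                   δ (suc (suc (suc (suc k)))) l + a * δ (suc (suc (suc k))) l + b * δ (suc (suc k)) l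
    colₖ k zero          = sym (zero-comb a b)
    colₖ k (suc zero)    = sym (zero-comb a b)
    colₖ k (suc (suc m)) = trans (toe-band (suc (suc m)) (suc (suc (suc (suc k)))))
      (cong₂ _+_ (cong₂ (λ u v → u + a * v) (δ-sym (suc (suc m)) (suc (suc (suc (suc k))))) (δ-sym (suc (suc m)) (suc (suc (suc k)))))
                 (cong (b *_) (δ-sym (suc (suc m)) (suc (suc k)))))
    drop-δ₁ : ∀ a b t u v → + 0 + t + a * (+ 0 + u) + b * (+ 0 + v) ≡ t + a * u + b * v
    drop-δ₁ = solve-∀
    entryᵢⱼ : ∀ i j → i < N → j < N → mul N X L (suc i) (suc j) ≡ δ (suc i) (suc j)
    entryᵢⱼ i zero _ j<N =
      trans (mul-sparseʳ N X L (suc i) 1 (+ 0) (+ 0) 0 0 0 (never j<N) (never j<N) (never j<N) col₁) (row i)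
      where row : ∀ i → X (suc i) 1 + + 0 * X (suc i) 1 + + 0 * X (suc i) 1 ≡ δ (suc i) 1
            row zero    = refl
            row (suc i) = refl
    entryᵢⱼ i (suc zero) _ j<N =
      trans (mul-sparseʳ N X L (suc i) 2 (- + 1) (+ 0) 1 0 0 (never j<N) (never (ℕP.<-trans (s≤s z≤n) j<N))
               (never (ℕP.<-trans (s≤s z≤n) j<N)) col₂) (row i)
      where row : ∀ i → X (suc i) 2 + - + 1 * X (suc i) 1 + + 0 * X (suc i) 1 ≡ δ (suc i) 2
            row zero          = refl
            row (suc zero)    = refl
            row (suc (suc i)) = refl
    entryᵢⱼ i (suc (suc zero)) _ j<N =
      trans (mul-sparseʳ N X L (suc i) 3 a (+ 0) 2 1 0 (never j<N) (never (ℕP.<-trans (s≤s (s≤s z≤n)) j<N))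
               (never (ℕP.<-trans (s≤s z≤n) j<N)) col₃) (row i)
      where row : ∀ i → X (suc i) 3 + a * X (suc i) 2 + + 0 * X (suc i) 1 ≡ δ (suc i) 3
            row zero                = solve₁ a
              where solve₁ : ∀ a → + 0 + - a + a * (+ 0 + + 1) + + 0 ≡ + 0
                    solve₁ = solve-∀
            row (suc zero)          = solve₂ a
              where solve₂ : ∀ a → - a + a * + 1 + + 0 ≡ + 0
                    solve₂ = solve-∀
            row (suc (suc zero))    = one-comb a (+ 0)
            row (suc (suc (suc i))) = zero-comb a (+ 0)
    entryᵢⱼ i (suc (suc (suc k))) _ j<N =
      trans (mul-sparseʳ N X L (suc i) (suc (suc (suc (suc k)))) a b (suc (suc (suc k))) (suc (suc k)) (suc k)
               (never j<N) (never (ℕP.<-trans (ℕP.n<1+n _) j<N))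
               (never (ℕP.<-trans (ℕP.<-trans (ℕP.n<1+n _) (ℕP.n<1+n _)) j<N)) (colₖ k)) (row i)
      where row : ∀ i → X (suc i) (suc (suc (suc (suc k)))) + a * X (suc i) (suc (suc (suc k)))
                          + b * X (suc i) (suc (suc k)) ≡ δ (suc i) (suc (suc (suc (suc k))))
            row zero    = trans (drop-δ₁ a b (toe g 2 (suc (suc (suc (suc k))))) (toe g 2 (suc (suc (suc k)))) (toe g 2 (suc (suc k))))
                            (toe-coband-row 2 (suc (suc k)))
            row (suc i) = toe-coband-row (suc (suc i)) (suc (suc k))

UpperTriangular : Matℕ → Set
UpperTriangular M = ∀ p j → suc j < p → M p (suc j) ≡ + 0

unitFrom : ℕ → Matℕ → Matℕ
unitFrom m M p q = if m ≤ᵇ q then δ p q else M p q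

unitFrom-≥ : ∀ m M p q → m ≤ q → unitFrom m M p q ≡ δ p q
unitFrom-≥ m M p q m≤q rewrite ≤ᵇ-true m≤q = refl

unitFrom-< : ∀ m M p q → q < m → unitFrom m M p q ≡ M p q
unitFrom-< m M p q q<m rewrite ≤ᵇ-false q<m = refl

-- Replacing the trailing columns of both factors by unit vectors keeps X T = 1:
-- the new columns of T pick out the new columns of X, which are unit vectors, and
-- the old columns of T vanish in the rows where X was changed.
unitFrom-inverse : ∀ N m {X T} → UpperTriangular T → mul N X T ≈[ N ] δ →
                   mul N (unitFrom m X) (unitFrom m T) ≈[ N ] δ
unitFrom-inverse N m {X} {T} T-upper XT≈1 = agree entryᵢⱼ
  where
  X′ T′ : Matℕ
  X′ = unitFrom m X
  T′ = unitFrom m T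
  entryᵢⱼ : ∀ i j → i < N → j < N → mul N X′ T′ (suc i) (suc j) ≡ δ (suc i) (suc j)
  entryᵢⱼ i j i<N j<N with m ℕP.≤? suc j
  ... | yes m≤q = begin
    ∑ N (λ l → X′ (suc i) l * T′ l (suc j))    ≡⟨ ∑-ext N (λ l → cong (X′ (suc i) l *_) (unitFrom-≥ m T l (suc j) m≤q)) ⟩
    ∑ N (λ l → X′ (suc i) l * δ l (suc j))     ≡⟨ sift-col N j (X′ (suc i)) j<N ⟩
    X′ (suc i) (suc j)                          ≡⟨ unitFrom-≥ m X (suc i) (suc j) m≤q ⟩
    δ (suc i) (suc j)                           ∎
    where open ≡-Reasoning
  ... | no m≰q = trans (∑-cong N unchanged) (entry XT≈1 i j i<N j<N)
    where
    q<m : suc j < m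
    q<m = ℕP.≰⇒> m≰q
    unchanged : ∀ l → l < N → X′ (suc i) (suc l) * T′ (suc l) (suc j) ≡ X (suc i) (suc l) * T (suc l) (suc j)
    unchanged l _ rewrite unitFrom-< m T (suc l) (suc j) q<m with m ℕP.≤? suc l
    ... | yes m≤l rewrite T-upper (suc l) j (ℕP.<-≤-trans q<m m≤l) =
          trans (*-zeroʳ (X′ (suc i) (suc l))) (sym (*-zeroʳ (X (suc i) (suc l))))
    ... | no m≰l = cong (_* T (suc l) (suc j)) (unitFrom-< m X (suc i) (suc l) (ℕP.≰⇒> m≰l))

apply : ℕ → Matℕ → (ℕ → ℤ) → ℕ → ℤ
apply N X u p = ∑ N (λ l → X p l * u l)

shearT : ℕ → (ℕ → ℤ) → Matℕ → Matℕ
shearT N u T p q = T p q - δ N q * u p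

shearX : ℕ → (ℕ → ℤ) → Matℕ → Matℕ
shearX N u X p q = X p q + δ N q * apply N X u p

LastRowUnit : ℕ → Matℕ → Set
LastRowUnit N M = ∀ j → j < N → M N (suc j) ≡ δ N (suc j)

-- If X and T are mutually inverse with last rows e_N and u_N = 0, then so are the
-- sheared matrices: X u compensates -u, and the cross terms vanish because the last
-- rows of X, T are e_N and u_N = 0.
shear-inverse : ∀ N u {X T} → u N ≡ + 0 → LastRowUnit N X → LastRowUnit N T →
  mul N X T ≈[ N ] δ → mul N T X ≈[ N ] δ →
  mul N (shearX N u X) (shearT N u T) ≈[ N ] δ × mul N (shearT N u T) (shearX N u X) ≈[ N ] δ
shear-inverse zero    u _ _ _ _ _ = agree (λ _ _ ()) , agree (λ _ _ ())
shear-inverse (suc K) u {X} {T} uN≡0 X-last T-last XT≈1 TX≈1 = agree XT⁺ , agree TX⁺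
  where
  N : ℕ
  N = suc K
  v : ℕ → ℤ
  v = apply N X u
  at-N : (f : ℕ → ℤ) → ∑ N (λ l → δ N l * f l) ≡ f N
  at-N f = sift N K f (λ N≤K → ⊥-elim (ℕP.1+n≰n N≤K))
  vN≡0 : v N ≡ + 0
  vN≡0 = trans (∑-cong N {f = λ l → X N l * u l} {g = λ l → δ N l * u l} (λ l l<N → cong (_* u (suc l)) (X-last l l<N))) (trans (at-N u) uN≡0)
  Tv≡u : ∀ i → i < N → apply N T v (suc i) ≡ u (suc i)
  Tv≡u i i<N = entry (≈-trans (≈-sym (mul-assoc N T X U)) (≈-trans (mul-congˡ N U TX≈1) (mul-identityˡ N U))) i i i<N i<N
    where U : Matℕ
          U l _ = u l
  XT⁺ : ∀ i j → i < N → j < N → mul N (shearX N u X) (shearT N u T) (suc i) (suc j) ≡ δ (suc i) (suc j)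
  XT⁺ i j i<N j<N = begin
    ∑ N (λ l → (X p l + δ N l * v p) * (T l q - δ N q * u l))
      ≡⟨ ∑-ext N (λ l → reorder (X p l) (δ N l) (v p) (T l q) (δ N q) (u l)) ⟩
    ∑ N (λ l → (X p l + v p * δ N l) * (T l q + (- δ N q) * u l))
      ≡⟨ ∑-bilinear N (X p) (δ N) (λ l → T l q) u (v p) (- δ N q) ⟩
    mul N X T p q + (- δ N q) * v p + v p * ∑ N (λ l → δ N l * T l q) + v p * (- δ N q) * ∑ N (λ l → δ N l * u l)
      ≡⟨ cong₂ (λ a b → a + (- δ N q) * v p + v p * b + v p * (- δ N q) * ∑ N (λ l → δ N l * u l))
               (entry XT≈1 i j i<N j<N) (trans (at-N (λ l → T l q)) (T-last j j<N)) ⟩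
    δ p q + (- δ N q) * v p + v p * δ N q + v p * (- δ N q) * ∑ N (λ l → δ N l * u l)
      ≡⟨ cong (λ a → δ p q + (- δ N q) * v p + v p * δ N q + v p * (- δ N q) * a) (trans (at-N u) uN≡0) ⟩
    δ p q + (- δ N q) * v p + v p * δ N q + v p * (- δ N q) * + 0
      ≡⟨ cancel (δ p q) (δ N q) (v p) ⟩
    δ p q ∎
    where
    open ≡-Reasoning
    p q : ℕ
    p = suc i
    q = suc j
    reorder : ∀ a b c d e f → (a + b * c) * (d - e * f) ≡ (a + c * b) * (d + (- e) * f)
    reorder = solve-∀
    cancel : ∀ a b c → a + (- b) * c + c * b + c * (- b) * + 0 ≡ a
    cancel = solve-∀
  TX⁺ : ∀ i j → i < N → j < N → mul N (shearT N u T) (shearX N u X) (suc i) (suc j) ≡ δ (suc i) (suc j)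
  TX⁺ i j i<N j<N = begin
    ∑ N (λ l → (T p l - δ N l * u p) * (X l q + δ N q * v l))
      ≡⟨ ∑-ext N (λ l → reorder (T p l) (δ N l) (u p) (X l q) (δ N q) (v l)) ⟩
    ∑ N (λ l → (T p l + (- u p) * δ N l) * (X l q + δ N q * v l))
      ≡⟨ ∑-bilinear N (T p) (δ N) (λ l → X l q) v (- u p) (δ N q) ⟩
    mul N T X p q + δ N q * apply N T v p + (- u p) * ∑ N (λ l → δ N l * X l q) + (- u p) * δ N q * ∑ N (λ l → δ N l * v l)
      ≡⟨ cong₂ (λ a b → a + δ N q * b + (- u p) * ∑ N (λ l → δ N l * X l q) + (- u p) * δ N q * ∑ N (λ l → δ N l * v l))
               (entry TX≈1 i j i<N j<N) (Tv≡u i i<N) ⟩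
    δ p q + δ N q * u p + (- u p) * ∑ N (λ l → δ N l * X l q) + (- u p) * δ N q * ∑ N (λ l → δ N l * v l)
      ≡⟨ cong₂ (λ a b → δ p q + δ N q * u p + (- u p) * a + (- u p) * δ N q * b)
               (trans (at-N (λ l → X l q)) (X-last j j<N)) (trans (at-N v) vN≡0) ⟩
    δ p q + δ N q * u p + (- u p) * δ N q + (- u p) * δ N q * + 0
      ≡⟨ cancel (δ p q) (δ N q) (u p) ⟩
    δ p q ∎
    where
    open ≡-Reasoning
    p q : ℕ
    p = suc i
    q = suc j
    reorder : ∀ a b c d e f → (a - b * c) * (d + e * f) ≡ (a + (- c) * b) * (d + e * f)
    reorder = solve-∀
    cancel : ∀ a b c → a + b * c + (- c) * b + (- c) * b * + 0 ≡ a
    cancel = solve-∀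

-- the row operations W (row p minus row p + 2), the banded matrix T = W G and their inverses
W V T X : Matℕ
W = banded (+ 0) (- + 1)
V = cobanded (+ 0) (- + 1)
T = banded (+ 1) (- + 1)
X = cobanded (+ 1) (- + 1)

-- the action of W on a column c (for an upper-triangular matrix, see W-action)
reduce : (ℕ → ℤ) → ℕ → ℤ
reduce c zero          = + 0
reduce c (suc zero)    = c 1 - c 2
reduce c (suc (suc p)) = c (suc (suc p)) - c (suc (suc (suc (suc p))))

beyond : ∀ {N A} → UpperTriangular A → ∀ {j} → j < N → ∀ k → N ≤ k → A (suc k) (suc j) ≡ + 0
beyond A-upper {j} j<N k N≤k = A-upper (suc k) j (s≤s (ℕP.<-≤-trans j<N N≤k))

W-action : ∀ N A → UpperTriangular A → ∀ i j → j < N → mul N W A (suc i) (suc j) ≡ reduce (λ l → A l (suc j)) (suc i)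
W-action N A A-upper zero j j<N =
  trans (mul-sparseˡ N W A 1 (suc j) (- + 1) (+ 0) 0 1 2 (vanish 0) (vanish 1) (vanish 2)
           (λ l → first-row (δ 1 l) (δ 2 l) (δ 3 l)))
        (simplify (A 1 (suc j)) (A 2 (suc j)) (A 3 (suc j)))
  where
  vanish : ∀ k → N ≤ k → A (suc k) (suc j) ≡ + 0
  vanish = beyond {N} {A} A-upper j<N
  first-row : ∀ u v w → u - v ≡ u + - + 1 * v + + 0 * w
  first-row = solve-∀
  simplify : ∀ a b c → a + - + 1 * b + + 0 * c ≡ a - b
  simplify = solve-∀
W-action N A A-upper (suc i) j j<N =
  trans (mul-sparseˡ N W A (suc (suc i)) (suc j) (+ 0) (- + 1) (suc i) (suc (suc i)) (suc (suc (suc i)))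
           (vanish _) (vanish _) (vanish _) (toe-band (+ 0) (- + 1) (suc (suc i))))
        (simplify (A (suc (suc i)) (suc j)) (A (suc (suc (suc i))) (suc j)) (A (suc (suc (suc (suc i)))) (suc j)))
  where
  vanish : ∀ k → N ≤ k → A (suc k) (suc j) ≡ + 0
  vanish = beyond {N} {A} A-upper j<N
  simplify : ∀ a b c → a + + 0 * b + - + 1 * c ≡ a - c
  simplify = solve-∀

-- parity (true for odd numbers), by the recursion that Toeplitz shifts follow
odd : ℕ → Bool
odd zero          = false
odd (suc zero)    = true
odd (suc (suc n)) = odd n

-- first rows of the Toeplitz parts: ones at odd distances (and on the diagonal),
-- respectively at even distances
oddStep evenStep : ℕ → ℤ
oddStep zero    = + 1
oddStep (suc d) = b2z (odd (suc d))
evenStep d = b2z (not (odd d))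

-- The generic columns of C₁, …, C₄: row 1 has ones in the odd columns, row p ≥ 2 a one on
-- the diagonal and at odd distances to its right.
G : Matℕ
G zero          q = + 0
G (suc zero)    q = b2z (odd q)
G (suc (suc p)) q = toe oddStep (suc (suc p)) q

-- the special columns: entry r in row 1, ones at even distances above the diagonal
E : ℤ → Matℕ
E r zero          q = + 0
E r (suc zero)    q = r
E r (suc (suc p)) q = toe evenStep (suc (suc p)) q

G⁻ : Matℕ
G⁻ p q = G p q - δ (suc p) q

withColumn : ℕ → (ℕ → ℤ) → Matℕ → Matℕ
withColumn k c M p q = if q ≡ᵇ k then c p else M p q

withColumn-at : ∀ k c M p → withColumn k c M p k ≡ c p
withColumn-at k c M p rewrite ≡ᵇ-true {k} refl = refl

withColumn-off : ∀ k c M p q → q ≢ k → withColumn k c M p q ≡ M p q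
withColumn-off k c M p q q≢k rewrite ≡ᵇ-false q≢k = refl

-- the models: A₁ has the special last column E r (C₁ for r = 0, C₄ for r = 1),
-- A₂ the columns E r and G⁻ in positions N - 1 and N (C₂ for r = 0, C₃ for r = 1)
A₁ A₂ : ℤ → ℕ → Matℕ
A₁ r N = withColumn N (λ p → E r p N) G
A₂ r N = withColumn N (λ p → G⁻ p N) (withColumn (N ∸ 1) (λ p → E r p (N ∸ 1)) G)

-- W G = T, W E = (unit column) and W G⁻ = T - (shifted unit column), column by column
reduce-cong : ∀ {c c′} → (∀ l → c l ≡ c′ l) → ∀ p → reduce c p ≡ reduce c′ p
reduce-cong c≗c′ zero          = refl
reduce-cong c≗c′ (suc zero)    = cong₂ _-_ (c≗c′ 1) (c≗c′ 2)
reduce-cong c≗c′ (suc (suc p)) = cong₂ _-_ (c≗c′ _) (c≗c′ _)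

oddStep-reduce : ∀ p q → toe oddStep p q - toe oddStep (suc (suc p)) q ≡ toe (band (+ 1) (- + 1)) p q
oddStep-reduce zero    zero                = refl
oddStep-reduce zero    (suc zero)          = refl
oddStep-reduce zero    (suc (suc zero))    = refl
oddStep-reduce zero    (suc (suc (suc d))) = +-inverseʳ (b2z (odd (suc d)))
oddStep-reduce (suc p) zero                = refl
oddStep-reduce (suc p) (suc q)             = oddStep-reduce p q

evenStep-reduce : ∀ p q → toe evenStep p q - toe evenStep (suc (suc p)) q ≡ δ p q
evenStep-reduce zero    zero                = refl
evenStep-reduce zero    (suc zero)          = refl
evenStep-reduce zero    (suc (suc zero))    = refl
evenStep-reduce zero    (suc (suc (suc d))) = +-inverseʳ (evenStep (suc d))
evenStep-reduce (suc p) zero                = refl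
evenStep-reduce (suc p) (suc q)             = evenStep-reduce p q

reduce-G : ∀ q p → reduce (λ l → G l q) (suc p) ≡ T (suc p) q
reduce-G zero                zero    = refl
reduce-G (suc zero)          zero    = refl
reduce-G (suc (suc zero))    zero    = refl
reduce-G (suc (suc (suc d))) zero    = +-inverseʳ (b2z (odd (suc d)))
reduce-G q                   (suc p) = oddStep-reduce (suc (suc p)) q

reduce-E : ∀ r q → r ≡ toe evenStep 2 q → q ≢ 1 → ∀ p → reduce (λ l → E r l q) (suc p) ≡ δ (suc p) q
reduce-E r q refl q≢1 zero    = trans (+-inverseʳ (toe evenStep 2 q)) (sym (cong b2z (≡ᵇ-false (λ 1≡q → q≢1 (sym 1≡q)))))
reduce-E r q _    _   (suc p) = evenStep-reduce (suc (suc p)) q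

reduce-− : ∀ (f g : ℕ → ℤ) p → reduce (λ l → f l - g l) p ≡ reduce f p - reduce g p
reduce-− f g zero          = refl
reduce-− f g (suc zero)    = swap (f 1) (g 1) (f 2) (g 2)
  where swap : ∀ a b c d → a - b - (c - d) ≡ a - c - (b - d)
        swap = solve-∀
reduce-− f g (suc (suc p)) = swap (f (suc (suc p))) (g (suc (suc p))) (f (suc (suc (suc (suc p))))) (g (suc (suc (suc (suc p)))))
  where swap : ∀ a b c d → a - b - (c - d) ≡ a - c - (b - d)
        swap = solve-∀

reduce-G⁻ : ∀ M → let N = suc (suc (suc (suc (suc M)))) in
  ∀ p → reduce (λ l → G⁻ l N) (suc p) ≡ δ (suc p) N - (δ (N ∸ 2) (suc p) - δ (N ∸ 3) (suc p))
reduce-G⁻ M p = trans (reduce-− (λ l → G l N) (λ l → δ (suc l) N) (suc p))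
                      (trans (cong (_- reduce (λ l → δ (suc l) N) (suc p)) (reduce-G N p)) (rows p))
  where
  N : ℕ
  N = suc (suc (suc (suc (suc M))))
  rows : ∀ p → T (suc p) N - reduce (λ l → δ (suc l) N) (suc p) ≡ δ (suc p) N - (δ (N ∸ 2) (suc p) - δ (N ∸ 3) (suc p))
  rows zero    = refl
  rows (suc p) = begin
    toe (band (+ 1) (- + 1)) (suc (suc p)) N - (δ (suc (suc (suc p))) N - δ (suc (suc (suc (suc (suc p))))) N)
      ≡⟨ cong (_- (δ (suc p₂) N - δ (suc (suc (suc p₂))) N)) (toe-band (+ 1) (- + 1) (suc (suc p)) N) ⟩
    δ p₂ N + + 1 * δ (suc p₂) N + - + 1 * δ (suc (suc p₂)) N - (δ (suc p₂) N - δ (suc (suc (suc p₂))) N)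
      ≡⟨ cancel (δ p₂ N) (δ (suc p₂) N) (δ (suc (suc p₂)) N) (δ (suc (suc (suc p₂))) N) ⟩
    δ p₂ N - (δ (suc (suc p₂)) N - δ (suc (suc (suc p₂))) N)
      ≡⟨ cong₂ (λ a b → δ p₂ N - (a - b)) (δ-sym p₂ (N ∸ 2)) (δ-sym p₂ (N ∸ 3)) ⟩
    δ p₂ N - (δ (N ∸ 2) p₂ - δ (N ∸ 3) p₂) ∎
    where
    open ≡-Reasoning
    p₂ : ℕ
    p₂ = suc (suc p)
    cancel : ∀ a b c d → a + + 1 * b + - + 1 * c - (b - d) ≡ a - (c - d)
    cancel = solve-∀

G-upper : UpperTriangular G
G-upper (suc zero)    j (s≤s ())
G-upper (suc (suc p)) j j<p = toe-below oddStep (suc (suc p)) (suc j) j<p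

E-upper : ∀ r → UpperTriangular (E r)
E-upper r (suc zero)    j (s≤s ())
E-upper r (suc (suc p)) j j<p = toe-below evenStep (suc (suc p)) (suc j) j<p

G⁻-upper : UpperTriangular G⁻
G⁻-upper p j j<p = cong₂ _-_ (G-upper p j j<p) (δ-off (λ p≡j → ℕP.<-irrefl (sym p≡j) (ℕP.<-trans (ℕP.n<1+n j) j<p)))

withColumn-upper : ∀ k c M → (∀ p → k < p → c p ≡ + 0) → UpperTriangular M → UpperTriangular (withColumn k c M)
withColumn-upper k c M c-upper M-upper p j j<p with suc j ℕP.≟ k
... | yes refl = trans (withColumn-at k c M p) (c-upper p j<p)
... | no  q≢k  = trans (withColumn-off k c M p (suc j) q≢k) (M-upper p j j<p)

A₁-upper : ∀ r N → 0 < N → UpperTriangular (A₁ r N)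
A₁-upper r (suc K) _ = withColumn-upper (suc K) _ G (λ p N<p → E-upper r p K N<p) G-upper

A₂-upper : ∀ r N → 1 < N → UpperTriangular (A₂ r N)
A₂-upper r (suc zero) (s≤s ())
A₂-upper r (suc (suc K)) _ =
  withColumn-upper _ _ (withColumn (suc K) (λ p → E r p (suc K)) G) (λ p N<p → G⁻-upper p (suc K) N<p)
    (withColumn-upper _ _ G (λ p N-1<p → E-upper r p K N-1<p) G-upper)

T-upper : UpperTriangular T
T-upper p j = banded-below (+ 1) (- + 1) p (suc j)

X-upper : UpperTriangular X
X-upper p j = cobanded-below (+ 1) (- + 1) p (suc j)

unitFrom-lastRow : ∀ N m M → UpperTriangular M → m ≤ N → LastRowUnit N (unitFrom m M)
unitFrom-lastRow N m M M-upper m≤N j j<N with m ℕP.≤? suc j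
... | yes m≤q = unitFrom-≥ m M N (suc j) m≤q
... | no  m≰q = trans (unitFrom-< m M N (suc j) q<m)
                      (trans (M-upper N j (ℕP.<-≤-trans q<m m≤N)) (sym (δ-off λ N≡q → ℕP.<-irrefl (sym N≡q) (ℕP.<-≤-trans q<m m≤N))))
  where q<m : suc j < m
        q<m = ℕP.≰⇒> m≰q

shift : ℕ → ℕ → ℤ
shift N l = δ (N ∸ 2) l - δ (N ∸ 3) l

T₁ X₁ T₂ X₂ : ℕ → Matℕ
T₁ N = unitFrom N T
X₁ N = unitFrom N X
T₂ N = shearT N (shift N) (unitFrom (N ∸ 1) T)
X₂ N = shearX N (shift N) (unitFrom (N ∸ 1) X)

V·W : ∀ N → mul N V W ≈[ N ] δ
V·W = cobanded·banded (+ 0) (- + 1)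

X₁·T₁ : ∀ N → mul N (X₁ N) (T₁ N) ≈[ N ] δ
X₁·T₁ N = unitFrom-inverse N N T-upper (cobanded·banded (+ 1) (- + 1) N)

T₁·X₁ : ∀ N → mul N (T₁ N) (X₁ N) ≈[ N ] δ
T₁·X₁ N = unitFrom-inverse N N X-upper (banded·cobanded (+ 1) (- + 1) N)

X₂·T₂×T₂·X₂ : ∀ M → let N = suc (suc (suc (suc (suc M)))) in
  mul N (X₂ N) (T₂ N) ≈[ N ] δ × mul N (T₂ N) (X₂ N) ≈[ N ] δ
X₂·T₂×T₂·X₂ M =
  shear-inverse N (shift N) {unitFrom (N ∸ 1) X} {unitFrom (N ∸ 1) T} shift-at-N
    (unitFrom-lastRow N (N ∸ 1) X X-upper (ℕP.n≤1+n _)) (unitFrom-lastRow N (N ∸ 1) T T-upper (ℕP.n≤1+n _))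
    (unitFrom-inverse N (N ∸ 1) {X} {T} T-upper (cobanded·banded (+ 1) (- + 1) N))
    (unitFrom-inverse N (N ∸ 1) {T} {X} X-upper (banded·cobanded (+ 1) (- + 1) N))
  where
  N : ℕ
  N = suc (suc (suc (suc (suc M))))
  shift-at-N : shift N N ≡ + 0
  shift-at-N = cong₂ _-_ (δ-off {N ∸ 2} {N} (λ e → ℕP.<-irrefl e (ℕP.m≤n+m _ 1)))
                         (δ-off {N ∸ 3} {N} (λ e → ℕP.<-irrefl e (ℕP.m≤n+m _ 2)))

-- the row reductions W A₁ = T₁ and W A₂ = T₂; here the first entry r of the special
-- column E has to match the parity pattern below it
W·A₁ : ∀ r N → r ≡ toe evenStep 2 N → 1 < N → mul N W (A₁ r N) ≈[ N ] T₁ N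
W·A₁ r N r≡ 1<N = agree λ i j _ j<N → trans (W-action N (A₁ r N) (A₁-upper r N (ℕP.<-trans (s≤s z≤n) 1<N)) i j j<N) (column i j j<N)
  where
  column : ∀ i j → j < N → reduce (λ l → A₁ r N l (suc j)) (suc i) ≡ T₁ N (suc i) (suc j)
  column i j j<N with suc j ℕP.≟ N
  ... | yes refl = begin
    reduce (λ l → A₁ r N l N) (suc i)     ≡⟨ reduce-cong (λ l → withColumn-at N (λ p → E r p N) G l) (suc i) ⟩
    reduce (λ l → E r l N) (suc i)        ≡⟨ reduce-E r N r≡ (λ N≡1 → ℕP.<-irrefl (sym N≡1) 1<N) i ⟩
    δ (suc i) N                            ≡⟨ unitFrom-≥ N T (suc i) N ℕP.≤-refl ⟨
    T₁ N (suc i) N                         ∎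
    where open ≡-Reasoning
  ... | no q≢N = begin
    reduce (λ l → A₁ r N l (suc j)) (suc i) ≡⟨ reduce-cong (λ l → withColumn-off N (λ p → E r p N) G l (suc j) q≢N) (suc i) ⟩
    reduce (λ l → G l (suc j)) (suc i)      ≡⟨ reduce-G (suc j) i ⟩
    T (suc i) (suc j)                       ≡⟨ unitFrom-< N T (suc i) (suc j) (ℕP.≤∧≢⇒< j<N q≢N) ⟨
    T₁ N (suc i) (suc j)                    ∎
    where open ≡-Reasoning

W·A₂ : ∀ r M → let N = suc (suc (suc (suc (suc M)))) in
  r ≡ toe evenStep 2 (N ∸ 1) → mul N W (A₂ r N) ≈[ N ] T₂ N
W·A₂ r M r≡ = agree λ i j _ j<N → trans (W-action N (A₂ r N) (A₂-upper r N (s≤s (s≤s z≤n))) i j j<N) (column i j j<N)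
  where
  N  = suc (suc (suc (suc (suc M))))
  cE cG⁻ : ℕ → ℤ
  cE p = E r p (N ∸ 1)
  cG⁻ p = G⁻ p N
  A′ T′ : Matℕ
  A′ = withColumn (N ∸ 1) cE G
  T′ = unitFrom (N ∸ 1) T
  N-1<N : N ∸ 1 < N
  N-1<N = ℕP.n<1+n _
  T₂-off : ∀ p q → q ≢ N → T₂ N p q ≡ T′ p q
  T₂-off p q q≢N = trans (cong (λ d → T′ p q - d * shift N p) (δ-off (λ N≡q → q≢N (sym N≡q)))) (+-identityʳ (T′ p q))
  column : ∀ i j → j < N → reduce (λ l → A₂ r N l (suc j)) (suc i) ≡ T₂ N (suc i) (suc j)
  column i j j<N with suc j ℕP.≟ N | suc j ℕP.≟ N ∸ 1
  ... | yes refl | _ = begin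
    reduce (λ l → A₂ r N l N) (suc i)                   ≡⟨ reduce-cong (λ l → withColumn-at N cG⁻ A′ l) (suc i) ⟩
    reduce cG⁻ (suc i)                                  ≡⟨ reduce-G⁻ M i ⟩
    δ (suc i) N - shift N (suc i)                       ≡⟨ cong (_-_ (δ (suc i) N)) (*-identityˡ (shift N (suc i))) ⟨
    δ (suc i) N - + 1 * shift N (suc i)                 ≡⟨ cong₂ (λ a d → a - d * shift N (suc i)) (unitFrom-≥ (N ∸ 1) T (suc i) N (ℕP.n≤1+n _))
                                                                  (cong b2z (≡ᵇ-true {N} refl)) ⟨
    T₂ N (suc i) N                                      ∎
    where open ≡-Reasoning
  ... | no q≢N | yes refl = begin
    reduce (λ l → A₂ r N l (N ∸ 1)) (suc i)  ≡⟨ reduce-cong (λ l → trans (withColumn-off N cG⁻ A′ l (N ∸ 1) q≢N) (withColumn-at (N ∸ 1) cE G l)) (suc i) ⟩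
    reduce cE (suc i)                        ≡⟨ reduce-E r (N ∸ 1) r≡ (λ ()) i ⟩
    δ (suc i) (N ∸ 1)                        ≡⟨ unitFrom-≥ (N ∸ 1) T (suc i) (N ∸ 1) ℕP.≤-refl ⟨
    T′ (suc i) (N ∸ 1)                       ≡⟨ T₂-off (suc i) (N ∸ 1) q≢N ⟨
    T₂ N (suc i) (N ∸ 1)                     ∎
    where open ≡-Reasoning
  ... | no q≢N | no q≢N-1 = begin
    reduce (λ l → A₂ r N l (suc j)) (suc i) ≡⟨ reduce-cong (λ l → trans (withColumn-off N cG⁻ A′ l (suc j) q≢N) (withColumn-off (N ∸ 1) cE G l (suc j) q≢N-1)) (suc i) ⟩
    reduce (λ l → G l (suc j)) (suc i)      ≡⟨ reduce-G (suc j) i ⟩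
    T (suc i) (suc j)                       ≡⟨ unitFrom-< (N ∸ 1) T (suc i) (suc j) (ℕP.≤∧≢⇒< (ℕP.≤-pred (ℕP.≤∧≢⇒< j<N q≢N)) q≢N-1) ⟨
    T′ (suc i) (suc j)                      ≡⟨ T₂-off (suc i) (suc j) q≢N ⟨
    T₂ N (suc i) (suc j)                    ∎
    where open ≡-Reasoning

odd-suc : ∀ n → odd (suc n) ≡ not (odd n)
odd-suc zero          = refl
odd-suc (suc zero)    = refl
odd-suc (suc (suc n)) = odd-suc n

isEven-odd : ∀ n → isEven n ≡ not (odd n)
isEven-odd zero          = refl
isEven-odd (suc zero)    = refl
isEven-odd (suc (suc n)) = isEven-odd n

mod2-odd : ∀ n → (n % 2 ≡ᵇ 1) ≡ odd n
mod2-odd zero          = refl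
mod2-odd (suc zero)    = refl
mod2-odd (suc (suc n)) = mod2-odd n

xor-not : ∀ a b → not a xor not b ≡ a xor b
xor-not true  b = refl
xor-not false b = not-involutive b

toe-oddStep-< : ∀ p c → p < c → toe oddStep p c ≡ b2z (odd p xor odd c)
toe-oddStep-< zero    (suc c) _ = refl
toe-oddStep-< (suc p) (suc c) (s≤s p<c)
  rewrite odd-suc p | odd-suc c | xor-not (odd p) (odd c) = toe-oddStep-< p c p<c

toe-evenStep-< : ∀ p c → p < c → toe evenStep p c ≡ b2z (not (odd p xor odd c))
toe-evenStep-< zero    (suc c) _ = refl
toe-evenStep-< (suc p) (suc c) (s≤s p<c)
  rewrite odd-suc p | odd-suc c | xor-not (odd p) (odd c) = toe-evenStep-< p c p<c

toe-superdiag : ∀ f p → toe f p (suc p) ≡ f 1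
toe-superdiag f zero    = refl
toe-superdiag f (suc p) = toe-superdiag f p

≡ᵇ-< : ∀ {p c} → p < c → (p ≡ᵇ c) ≡ false
≡ᵇ-< p<c = ≡ᵇ-false (ℕP.<⇒≢ p<c)

≡ᵇ-> : ∀ {p c} → c < p → (p ≡ᵇ c) ≡ false
≡ᵇ-> c<p = ≡ᵇ-false (ℕP.>⇒≢ c<p)

not-fixed : ∀ b → ¬ b ≡ not b
not-fixed true  ()
not-fixed false ()

same-parity-gap : ∀ p c → p < c → odd p ≡ odd c → p ≤ c ∸ 2
same-parity-gap p c p<c same with ℕP.m≤n⇒m<n∨m≡n p<c
... | inj₂ refl  = ⊥-elim (not-fixed (odd p) (trans same (odd-suc p)))
... | inj₁ p+2≤c = drop p+2≤c
  where drop : ∀ {p c} → suc (suc p) ≤ c → p ≤ c ∸ 2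
        drop (s≤s (s≤s p≤c)) = p≤c

opposite-parity-gap : ∀ p c → suc p < c → odd p ≢ odd c → p ≤ c ∸ 3
opposite-parity-gap p c p+1<c opposite with ℕP.m≤n⇒m<n∨m≡n p+1<c
... | inj₂ refl  = ⊥-elim (opposite (sym (trans (odd-suc (suc p)) (trans (cong not (odd-suc p)) (not-involutive (odd p))))))
... | inj₁ p+3≤c = drop p+3≤c
  where drop : ∀ {p c} → suc (suc (suc p)) ≤ c → p ≤ c ∸ 3
        drop (s≤s (s≤s (s≤s p≤c))) = p≤c

-- The generic columns of Defs are the columns of G.  Above the diagonal, column q of G
-- marks row 1 if q is odd and the rows p ≥ 2 of parity opposite to q.
colGen-G : ∀ q p → 1 ≤ q → 1 ≤ p → b2z (colGen q p) ≡ G p q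
colGen-G (suc zero)       (suc zero)          _ _ = refl
colGen-G (suc zero)       (suc (suc p))       _ _ = refl
colGen-G (suc (suc zero)) (suc zero)          _ _ = refl
colGen-G (suc (suc zero)) (suc (suc zero))    _ _ = refl
colGen-G (suc (suc zero)) (suc (suc (suc p))) _ _ = refl
colGen-G q@(suc (suc (suc q′))) p _ _ rewrite isEven-odd q with odd q in odd-q
colGen-G q@(suc (suc (suc q′))) (suc zero) _ _ | true  rewrite odd-q = refl
colGen-G q@(suc (suc (suc q′))) (suc zero) _ _ | false rewrite odd-q = refl
colGen-G q@(suc (suc (suc q′))) p@(suc (suc p′)) _ _ | true with ℕP.<-cmp p q
... | tri< p<q _ _ rewrite ≡ᵇ-< p<q | ≤ᵇ-true (ℕP.≤-pred p<q) | isEven-odd p | toe-oddStep-< p q p<q | odd-q with odd p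
...   | true  = refl
...   | false = refl
colGen-G q@(suc (suc (suc q′))) p@(suc (suc p′)) _ _ | true | tri≈ _ refl _
  rewrite ≡ᵇ-true {p} refl | toe-diag oddStep p | ∨-zeroʳ (isEven p ∧ (p ≤ᵇ (q ∸ 1))) = refl
colGen-G q@(suc (suc (suc q′))) p@(suc (suc p′)) _ _ | true | tri> _ _ q<p
  rewrite ≡ᵇ-> q<p | ≤ᵇ-false (ℕP.<-trans (ℕP.n<1+n _) q<p) | toe-below oddStep p q q<p with isEven p
...   | true  = refl
...   | false = refl
colGen-G q@(suc (suc (suc q′))) (suc (suc zero)) _ _ | false with ℕP.<-cmp 2 q
... | tri< 2<q _ _ rewrite ≡ᵇ-< 2<q | toe-oddStep-< 2 q 2<q | odd-q = refl
... | tri≈ _ () _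
... | tri> _ _ (s≤s (s≤s ()))
colGen-G q@(suc (suc (suc q′))) p@(suc (suc (suc p″))) _ _ | false with ℕP.<-cmp p q
... | tri< p<q _ _ rewrite ≡ᵇ-< p<q | mod2-odd p | toe-oddStep-< p q p<q | odd-q with odd p
...   | true rewrite ≤ᵇ-true (ℕP.≤-pred p<q) = refl
...   | false = refl
colGen-G q@(suc (suc (suc q′))) p@(suc (suc (suc p″))) _ _ | false | tri≈ _ refl _
  rewrite ≡ᵇ-true {p} refl | toe-diag oddStep p | ∨-zeroʳ ((p % 2 ≡ᵇ 1) ∧ (p ≤ᵇ (q ∸ 1))) = refl
colGen-G q@(suc (suc (suc q′))) p@(suc (suc (suc p″))) _ _ | false | tri> _ _ q<p
  rewrite ≡ᵇ-> q<p | ≤ᵇ-false (ℕP.<-trans (ℕP.n<1+n _) q<p) | toe-below oddStep p q q<p with p % 2 ≡ᵇ 1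
...   | true  = refl
...   | false = refl

special-odd : ∀ c p → 2 ≤ c → odd c ≡ true → 1 ≤ p → b2z (oddIn p 3 (c ∸ 2) ∨ (p ≡ᵇ c)) ≡ E (+ 0) p c
special-odd (suc zero) _ (s≤s ()) _ _
special-odd (suc (suc c′)) (suc zero) _ _ _ = refl
special-odd (suc (suc zero)) (suc (suc zero)) _ () _
special-odd (suc (suc (suc c″))) (suc (suc zero)) _ odd-c _ rewrite odd-suc c″ with odd c″
... | false = refl
special-odd c@(suc (suc c′)) p@(suc (suc (suc p″))) _ odd-c _ with ℕP.<-cmp p c
... | tri< p<c _ _ rewrite ≡ᵇ-< p<c | mod2-odd p | toe-evenStep-< p c p<c | odd-c with odd p in odd-p
...   | true rewrite ≤ᵇ-true (same-parity-gap p c p<c (trans odd-p (sym odd-c))) = refl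
...   | false = refl
special-odd c@(suc (suc c′)) p@(suc (suc (suc p″))) _ _ _ | tri≈ _ refl _
  rewrite ≡ᵇ-true {p} refl | toe-diag evenStep p | ∨-zeroʳ ((p % 2 ≡ᵇ 1) ∧ (p ≤ᵇ (c ∸ 2))) = refl
special-odd c@(suc (suc c′)) p@(suc (suc (suc p″))) _ _ _ | tri> _ _ c<p
  rewrite ≡ᵇ-> c<p | ≤ᵇ-false (ℕP.≤-<-trans (ℕP.m∸n≤m c 2) c<p) | toe-below evenStep p c c<p with p % 2 ≡ᵇ 1
...   | true  = refl
...   | false = refl

special-even : ∀ c p → 2 ≤ c → odd c ≡ false → 1 ≤ p → b2z ((p ≡ᵇ 1) ∨ evenIn p 2 (c ∸ 2) ∨ (p ≡ᵇ c)) ≡ E (+ 1) p c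
special-even c (suc zero) _ _ _ = refl
special-even c@(suc (suc c′)) p@(suc (suc p′)) _ odd-c _ with ℕP.<-cmp p c
... | tri< p<c _ _ rewrite ≡ᵇ-< p<c | isEven-odd p | toe-evenStep-< p c p<c | odd-c with odd p in odd-p
...   | false rewrite ≤ᵇ-true (same-parity-gap p c p<c (trans odd-p (sym odd-c))) = refl
...   | true  = refl
special-even c@(suc (suc c′)) p@(suc (suc p′)) _ _ _ | tri≈ _ refl _
  rewrite ≡ᵇ-true {p} refl | toe-diag evenStep p | ∨-zeroʳ (isEven p ∧ (p ≤ᵇ (c ∸ 2))) = refl
special-even c@(suc (suc c′)) p@(suc (suc p′)) _ _ _ | tri> _ _ c<p
  rewrite ≡ᵇ-> c<p | ≤ᵇ-false (ℕP.≤-<-trans (ℕP.m∸n≤m c 2) c<p) | toe-below evenStep p c c<p with isEven p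
...   | true  = refl
...   | false = refl

G⁻-even : ∀ N p → 3 ≤ N → odd N ≡ false → 1 ≤ p → p ≤ N → b2z (oddIn p 3 (N ∸ 3) ∨ (p ≡ᵇ N)) ≡ G⁻ p N
G⁻-even (suc (suc zero)) _ (s≤s (s≤s ())) _ _ _
G⁻-even N@(suc (suc (suc N′))) (suc zero) _ odd-N _ _ rewrite odd-N = refl
G⁻-even (suc (suc (suc zero))) (suc (suc zero)) _ () _ _
G⁻-even N@(suc (suc (suc (suc N″)))) (suc (suc zero)) _ odd-N _ _ rewrite odd-N = refl
G⁻-even N@(suc (suc (suc N′))) p@(suc (suc (suc p″))) _ odd-N _ p≤N with ℕP.<-cmp (suc p) N
... | tri< p+1<N _ _ rewrite ≡ᵇ-< (ℕP.<-trans (ℕP.n<1+n p) p+1<N) | mod2-odd p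
                           | toe-oddStep-< p N (ℕP.<-trans (ℕP.n<1+n p) p+1<N) | odd-N | ≡ᵇ-< p+1<N with odd p in odd-p
...   | true rewrite ≤ᵇ-true (opposite-parity-gap p N p+1<N (λ e → not-fixed true (trans (trans (sym odd-p) e) odd-N))) = refl
...   | false = refl
G⁻-even N@(suc (suc (suc N′))) p@(suc (suc (suc p″))) _ _ _ _ | tri≈ _ refl _
  rewrite ≡ᵇ-< (ℕP.n<1+n p) | ≤ᵇ-false {p} {p ∸ 2} (ℕP.n≤1+n _)
        | toe-superdiag oddStep p | ≡ᵇ-true {p} refl with p % 2 ≡ᵇ 1
...   | true  = refl
...   | false = refl
G⁻-even N@(suc (suc (suc N′))) p@(suc (suc (suc p″))) _ _ _ p≤N | tri> _ _ N<p+1 with ℕP.≤-antisym p≤N (ℕP.≤-pred N<p+1)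
... | refl rewrite ≡ᵇ-true {p} refl | toe-diag oddStep p | ∨-zeroʳ ((p % 2 ≡ᵇ 1) ∧ (p ≤ᵇ (N ∸ 3))) | ≡ᵇ-> (ℕP.n<1+n N) = refl

G⁻-odd : ∀ N p → 3 ≤ N → odd N ≡ true → 1 ≤ p → p ≤ N → b2z ((p ≡ᵇ 1) ∨ evenIn p 2 (N ∸ 3) ∨ (p ≡ᵇ N)) ≡ G⁻ p N
G⁻-odd (suc zero) _ (s≤s ()) _ _ _
G⁻-odd N@(suc (suc (suc N′))) (suc zero) _ odd-N _ _ rewrite odd-N = refl
G⁻-odd N@(suc (suc (suc N′))) p@(suc (suc p′)) _ odd-N _ p≤N with ℕP.<-cmp (suc p) N
... | tri< p+1<N _ _ rewrite ≡ᵇ-< (ℕP.<-trans (ℕP.n<1+n p) p+1<N) | isEven-odd p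
                           | toe-oddStep-< p N (ℕP.<-trans (ℕP.n<1+n p) p+1<N) | odd-N | ≡ᵇ-< p+1<N with odd p in odd-p
...   | false rewrite ≤ᵇ-true (opposite-parity-gap p N p+1<N (λ e → not-fixed false (trans (trans (sym odd-p) e) odd-N))) = refl
...   | true  = refl
G⁻-odd N@(suc (suc (suc N′))) p@(suc (suc p′)) _ _ _ _ | tri≈ _ refl _
  rewrite ≡ᵇ-< (ℕP.n<1+n p) | ≤ᵇ-false {p} {p ∸ 2} (ℕP.n≤1+n _)
        | toe-superdiag oddStep p | ≡ᵇ-true {p} refl with isEven p
...   | true  = refl
...   | false = refl
G⁻-odd N@(suc (suc (suc N′))) p@(suc (suc p′)) _ _ _ p≤N | tri> _ _ N<p+1 with ℕP.≤-antisym p≤N (ℕP.≤-pred N<p+1)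
... | refl rewrite ≡ᵇ-true {p} refl | toe-diag oddStep p | ∨-zeroʳ (isEven p ∧ (p ≤ᵇ (N ∸ 3))) | ≡ᵇ-> (ℕP.n<1+n N) = refl

asℕ : (ℕ → ℕ → ℕ → Bool) → ℕ → Matℕ
asℕ c n p q = b2z (c n p q)

-- for n = M + 6 and N = n - 1, each of C₁, …, C₄ agrees with its model on the N × N block
module Models (M : ℕ) where
  N : ℕ
  N = suc (suc (suc (suc (suc M))))

  3≤N : 3 ≤ N
  3≤N = s≤s (s≤s (s≤s z≤n))

  odd-N-1 : odd (N ∸ 1) ≡ not (odd N)
  odd-N-1 = trans (sym (not-involutive _)) (cong not (sym (odd-suc (N ∸ 1))))

  C₁≈A₁ : odd N ≡ true → asℕ c1 (suc N) ≈[ N ] A₁ (+ 0) N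
  C₁≈A₁ odd-N = agree entryᵢⱼ
    where
    entryᵢⱼ : ∀ i j → i < N → j < N → asℕ c1 (suc N) (suc i) (suc j) ≡ A₁ (+ 0) N (suc i) (suc j)
    entryᵢⱼ i j _ _ with suc j ℕP.≟ N
    ... | yes refl rewrite ≡ᵇ-true {N} refl = special-odd N (suc i) (s≤s (s≤s z≤n)) odd-N (s≤s z≤n)
    ... | no  q≢N  rewrite ≡ᵇ-false q≢N    = colGen-G (suc j) (suc i) (s≤s z≤n) (s≤s z≤n)

  C₄≈A₁ : odd N ≡ false → asℕ c4 (suc N) ≈[ N ] A₁ (+ 1) N
  C₄≈A₁ odd-N = agree entryᵢⱼ
    where
    entryᵢⱼ : ∀ i j → i < N → j < N → asℕ c4 (suc N) (suc i) (suc j) ≡ A₁ (+ 1) N (suc i) (suc j)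
    entryᵢⱼ i j _ _ with suc j ℕP.≟ N
    ... | yes refl rewrite ≡ᵇ-true {N} refl = special-even N (suc i) (s≤s (s≤s z≤n)) odd-N (s≤s z≤n)
    ... | no  q≢N  rewrite ≡ᵇ-false q≢N    = colGen-G (suc j) (suc i) (s≤s z≤n) (s≤s z≤n)

  N-1≢N : N ∸ 1 ≢ N
  N-1≢N = ℕP.<⇒≢ (ℕP.n<1+n _)

  N≢N-1 : N ≢ N ∸ 1
  N≢N-1 = ℕP.>⇒≢ (ℕP.n<1+n _)

  C₂≈A₂ : odd N ≡ false → asℕ c2 (suc N) ≈[ N ] A₂ (+ 0) N
  C₂≈A₂ odd-N = agree entryᵢⱼ
    where
    entryᵢⱼ : ∀ i j → i < N → j < N → asℕ c2 (suc N) (suc i) (suc j) ≡ A₂ (+ 0) N (suc i) (suc j)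
    entryᵢⱼ i j i<N _ with suc j ℕP.≟ N | suc j ℕP.≟ N ∸ 1
    ... | yes refl | _ rewrite ≡ᵇ-false N≢N-1 | ≡ᵇ-true {N} refl =
          G⁻-even N (suc i) 3≤N odd-N (s≤s z≤n) i<N
    ... | no q≢N | yes refl rewrite ≡ᵇ-true {N ∸ 1} refl | ≡ᵇ-false N-1≢N =
          special-odd (N ∸ 1) (suc i) (s≤s (s≤s z≤n)) (trans odd-N-1 (cong not odd-N)) (s≤s z≤n)
    ... | no q≢N | no q≢N-1 rewrite ≡ᵇ-false q≢N-1 | ≡ᵇ-false q≢N = colGen-G (suc j) (suc i) (s≤s z≤n) (s≤s z≤n)

  C₃≈A₂ : odd N ≡ true → asℕ c3 (suc N) ≈[ N ] A₂ (+ 1) N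
  C₃≈A₂ odd-N = agree entryᵢⱼ
    where
    entryᵢⱼ : ∀ i j → i < N → j < N → asℕ c3 (suc N) (suc i) (suc j) ≡ A₂ (+ 1) N (suc i) (suc j)
    entryᵢⱼ i j i<N _ with suc j ℕP.≟ N | suc j ℕP.≟ N ∸ 1
    ... | yes refl | _ rewrite ≡ᵇ-false N≢N-1 | ≡ᵇ-true {N} refl =
          G⁻-odd N (suc i) 3≤N odd-N (s≤s z≤n) i<N
    ... | no q≢N | yes refl rewrite ≡ᵇ-true {N ∸ 1} refl | ≡ᵇ-false N-1≢N =
          special-even (N ∸ 1) (suc i) (s≤s (s≤s z≤n)) (trans odd-N-1 (cong not odd-N)) (s≤s z≤n)
    ... | no q≢N | no q≢N-1 rewrite ≡ᵇ-false q≢N-1 | ≡ᵇ-false q≢N = colGen-G (suc j) (suc i) (s≤s z≤n) (s≤s z≤n)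

sgn : ℕ → ℤ
sgn zero    = + 1
sgn (suc n) = - sgn n

coband-fib : ∀ d → coband (+ 1) (- + 1) d ≡ sgn d * + fib (suc d)
coband-fib zero          = refl
coband-fib (suc zero)    = refl
coband-fib (suc (suc d)) = begin
  - (+ 1 * coband (+ 1) (- + 1) (suc d) + - + 1 * coband (+ 1) (- + 1) d)
    ≡⟨ cong₂ (λ x y → - (+ 1 * x + - + 1 * y)) (coband-fib (suc d)) (coband-fib d) ⟩
  - (+ 1 * (- sgn d * + fib (suc (suc d))) + - + 1 * (sgn d * + fib (suc d)))
    ≡⟨ collect (sgn d) (+ fib (suc (suc d))) (+ fib (suc d)) ⟩
  - - sgn d * (+ fib (suc (suc d)) + + fib (suc d))
    ≡⟨ cong (- - sgn d *_) (sym (pos-+ (fib (suc (suc d))) (fib (suc d)))) ⟩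
  - - sgn d * + fib (suc (suc (suc d))) ∎
  where
  open ≡-Reasoning
  collect : ∀ s a b → - (+ 1 * (- s * a) + - + 1 * (s * b)) ≡ - - s * (a + b)
  collect = solve-∀

prefix : (ℕ → ℤ) → ℕ → ℤ
prefix f zero    = + 0
prefix f (suc m) = f m + prefix f m

∑-toe-column : ∀ f m → ∑ m (λ p → toe f p m) ≡ prefix f m
∑-toe-column f zero    = refl
∑-toe-column f (suc m) = cong (_+_ (f m)) (∑-toe-column f m)

prefix-fib : ∀ m → prefix (coband (+ 1) (- + 1)) (suc m) ≡ + 1 + sgn m * + fib m
prefix-fib zero    = refl
prefix-fib (suc m) = begin
  coband (+ 1) (- + 1) (suc m) + prefix (coband (+ 1) (- + 1)) (suc m)
    ≡⟨ cong₂ _+_ (coband-fib (suc m)) (prefix-fib m) ⟩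
  - sgn m * + fib (suc (suc m)) + (+ 1 + sgn m * + fib m)
    ≡⟨ cong (λ x → - sgn m * x + (+ 1 + sgn m * + fib m)) (pos-+ (fib (suc m)) (fib m)) ⟩
  - sgn m * (+ fib (suc m) + + fib m) + (+ 1 + sgn m * + fib m)
    ≡⟨ cancel (sgn m) (+ fib (suc m)) (+ fib m) ⟩
  + 1 + - sgn m * + fib (suc m) ∎
  where
  open ≡-Reasoning
  cancel : ∀ s a b → - s * (a + b) + (+ 1 + s * b) ≡ + 1 + - s * a
  cancel = solve-∀

colsum-X : ∀ N k → suc (suc k) ≤ N → ∑ N (λ p → X p (suc (suc k))) ≡ + 1 + sgn k * + fib (suc (suc k))
colsum-X (suc N′) k (s≤s k+1≤N′) = begin
  X 1 (suc (suc k)) + ∑ N′ (λ p → X (suc p) (suc (suc k)))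
    ≡⟨ cong₂ _+_ (+-identityˡ (g k)) (∑-cong N′ (λ _ _ → refl)) ⟩
  g k + ∑ N′ (λ p → toe g p (suc k))
    ≡⟨ cong (_+_ (g k)) (∑-trunc (suc k) N′ _ k+1≤N′ (λ p k+1<p → toe-below g p (suc k) k+1<p)) ⟩
  g k + ∑ (suc k) (λ p → toe g p (suc k))
    ≡⟨ cong₂ _+_ (coband-fib k) (trans (∑-toe-column g (suc k)) (prefix-fib k)) ⟩
  sgn k * + fib (suc k) + (+ 1 + sgn k * + fib k)
    ≡⟨ collect (sgn k) (+ fib (suc k)) (+ fib k) ⟩
  + 1 + sgn k * (+ fib (suc k) + + fib k)
    ≡⟨ cong (λ x → + 1 + sgn k * x) (sym (pos-+ (fib (suc k)) (fib k))) ⟩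
  + 1 + sgn k * + fib (suc (suc k)) ∎
  where
  open ≡-Reasoning
  g : ℕ → ℤ
  g = coband (+ 1) (- + 1)
  collect : ∀ s a b → s * a + (+ 1 + s * b) ≡ + 1 + s * (a + b)
  collect = solve-∀

∑-δ-in : ∀ N k → k < N → ∑ N (δ (suc k)) ≡ + 1
∑-δ-in N k k<N = trans (∑-ext N (λ l → sym (*-identityʳ (δ (suc k) l)))) (sift-in N k (λ _ → + 1) k<N)

∑-δ-out : ∀ N k → N ≤ k → ∑ N (δ (suc k)) ≡ + 0
∑-δ-out N k N≤k = ∑-zero N (λ i i<N → δ-off (λ k+1≡i+1 → ℕP.<⇒≱ i<N (subst (N ≤_) (ℕP.suc-injective k+1≡i+1) N≤k)))

-- Row p of W sums to 1 exactly when p is one of the last two rows N - 1, N: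
-- otherwise its entries 1 and -1 both lie in the range.
rowsum-W : ∀ N → 3 ≤ N → ∀ i → i < N → ∑ N (W (suc i)) ≡ δ (N ∸ 1) (suc i) + δ N (suc i)
rowsum-W (suc zero)       (s≤s ()) _ _
rowsum-W (suc (suc zero)) (s≤s (s≤s ())) _ _
rowsum-W N@(suc (suc (suc K))) _ zero _ = trans (∑-- N (δ 1) (δ 2)) (cong₂ _-_ (∑-δ-in N 0 (s≤s z≤n)) (∑-δ-in N 1 (s≤s (s≤s z≤n))))
rowsum-W N@(suc (suc (suc K))) _ (suc i) i<N = begin
  ∑ N (toe (band (+ 0) (- + 1)) p)
    ≡⟨ ∑-ext N {toe (band (+ 0) (- + 1)) p} (toe-band (+ 0) (- + 1) p) ⟩
  ∑ N (λ l → δ p l + + 0 * δ (suc p) l + - + 1 * δ (suc (suc p)) l)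
    ≡⟨ trans (∑-+ N (λ l → δ p l + + 0 * δ (suc p) l) (λ l → - + 1 * δ (suc (suc p)) l))
             (cong₂ _+_ (trans (∑-+ N (δ p) (λ l → + 0 * δ (suc p) l)) (cong (_+_ (∑ N (δ p))) (∑-*ˡ N (+ 0) (δ (suc p)))))
                        (∑-*ˡ N (- + 1) (δ (suc (suc p))))) ⟩
  ∑ N (δ p) + + 0 * ∑ N (δ (suc p)) + - + 1 * ∑ N (δ (suc (suc p)))
    ≡⟨ cong (λ x → x + + 0 * ∑ N (δ (suc p)) + - + 1 * ∑ N (δ (suc (suc p)))) (∑-δ-in N (suc i) i<N) ⟩
  + 1 + + 0 * ∑ N (δ (suc p)) + - + 1 * ∑ N (δ (suc (suc p)))
    ≡⟨ last-two (suc (suc (suc (suc i))) ℕP.≤? N) ⟩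
  δ (N ∸ 1) p + δ N p ∎
  where
  open ≡-Reasoning
  p : ℕ
  p = suc (suc i)
  last-two : Dec (suc (suc (suc (suc i))) ≤ N) → + 1 + + 0 * ∑ N (δ (suc p)) + - + 1 * ∑ N (δ (suc (suc p))) ≡ δ (N ∸ 1) p + δ N p
  last-two (yes p+2≤N) = trans (cancel (∑ N (δ (suc p))) (∑-δ-in N (suc p) p+2≤N))
    (sym (cong₂ _+_ (δ-off (ℕP.>⇒≢ (ℕP.≤-pred (ℕP.≤-pred p+2≤N)))) (δ-off (ℕP.>⇒≢ (ℕP.≤-trans (ℕP.n≤1+n _) (ℕP.≤-pred p+2≤N))))))
    where cancel : ∀ x {y} → y ≡ + 1 → + 1 + + 0 * x + - + 1 * y ≡ + 0 + + 0
          cancel x refl = solve₀ x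
            where solve₀ : ∀ x → + 1 + + 0 * x + - + 1 * + 1 ≡ + 0 + + 0
                  solve₀ = solve-∀
  last-two (no p+2≰N) = trans (cong (λ y → + 1 + + 0 * ∑ N (δ (suc p)) + - + 1 * y) (∑-δ-out N (suc p) (ℕP.≤-pred (ℕP.≰⇒> p+2≰N))))
    (trans (one (∑ N (δ (suc p)))) (sym (one-of (ℕP.≤-pred (ℕP.≤-pred i<N)) (ℕP.≤-pred (ℕP.≤-pred (ℕP.≤-pred (ℕP.≤-pred (ℕP.≰⇒> p+2≰N))))))))
    where
    one : ∀ x → + 1 + + 0 * x + - + 1 * + 0 ≡ + 1
    one = solve-∀
    -- here p = i + 2 ∈ {N - 1, N}, i.e. i ∈ {K, K + 1}
    one-of : i ≤ suc K → K ≤ i → δ K i + δ (suc K) i ≡ + 1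
    one-of i≤K+1 K≤i with ℕP.m≤n⇒m<n∨m≡n K≤i
    ... | inj₂ refl = cong₂ _+_ (cong b2z (≡ᵇ-true {K} refl)) (δ-off (ℕP.>⇒≢ (ℕP.n<1+n K)))
    ... | inj₁ K<i rewrite ℕP.≤-antisym i≤K+1 K<i = cong₂ _+_ (δ-off (ℕP.<⇒≢ (ℕP.n<1+n K))) (cong b2z (≡ᵇ-true {suc K} refl))

-- The entries of Y W sum to the sums of the last two columns of Y, since only the last
-- two rows of W have nonzero row sums (both 1).
∑∑-·W : ∀ K (Y : Matℕ) → let N = suc (suc (suc K)) in
  ∑ N (λ p → ∑ N (mul N Y W p)) ≡ ∑ N (λ p → Y p (N ∸ 1)) + ∑ N (λ p → Y p N)
∑∑-·W K Y = begin
  ∑ N (λ p → ∑ N (λ q → ∑ N (λ l → Y p l * W l q)))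
    ≡⟨ ∑-ext N (λ p → ∑-swap N N (λ q l → Y p l * W l q)) ⟩
  ∑ N (λ p → ∑ N (λ l → ∑ N (λ q → Y p l * W l q)))
    ≡⟨ ∑-ext N (λ p → ∑-ext N (λ l → ∑-*ˡ N (Y p l) (W l))) ⟩
  ∑ N (λ p → ∑ N (λ l → Y p l * ∑ N (W l)))
    ≡⟨ ∑-swap N N (λ p l → Y p l * ∑ N (W l)) ⟩
  ∑ N (λ l → ∑ N (λ p → Y p l * ∑ N (W l)))
    ≡⟨ ∑-ext N (λ l → ∑-*ʳ N (∑ N (W l)) (λ p → Y p l)) ⟩
  ∑ N (λ l → colsum l * ∑ N (W l))
    ≡⟨ ∑-cong N {f = λ l → colsum l * ∑ N (W l)} {g = λ l → (δ (N ∸ 1) l + + 1 * δ N l + + 0 * δ N l) * colsum l}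
         (λ i i<N → trans (cong (colsum (suc i) *_) (rowsum-W N (s≤s (s≤s (s≤s z≤n))) i i<N))
                          (spread (colsum (suc i)) (δ (N ∸ 1) (suc i)) (δ N (suc i)))) ⟩
  ∑ N (λ l → (δ (N ∸ 1) l + + 1 * δ N l + + 0 * δ N l) * colsum l)
    ≡⟨ sift₃ N (+ 1) (+ 0) colsum (sift-in N (suc K) colsum (ℕP.≤-trans (ℕP.n<1+n _) (ℕP.n≤1+n _))) at-N at-N ⟩
  colsum (N ∸ 1) + + 1 * colsum N + + 0 * colsum N
    ≡⟨ tidy (colsum (N ∸ 1)) (colsum N) ⟩
  colsum (N ∸ 1) + colsum N ∎
  where
  open ≡-Reasoning
  N : ℕ
  N = suc (suc (suc K))
  colsum : ℕ → ℤ
  colsum l = ∑ N (λ p → Y p l)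
  at-N : ∑ N (λ l → δ N l * colsum l) ≡ colsum N
  at-N = sift-in N (suc (suc K)) colsum (ℕP.n<1+n _)
  spread : ∀ c a b → c * (a + b) ≡ (a + + 1 * b + + 0 * b) * c
  spread = solve-∀
  tidy : ∀ a b → a + + 1 * b + + 0 * b ≡ a + b
  tidy = solve-∀

block : (N : ℕ) → Matℕ → Mat N
block N P i j = P (suc (toℕ i)) (suc (toℕ j))

sumFin-∑ : ∀ N (F : ℕ → ℤ) → sumFin N (λ i → F (suc (toℕ i))) ≡ ∑ N F
sumFin-∑ zero    F = refl
sumFin-∑ (suc N) F = cong (_+_ (F 1)) (sumFin-∑ N (λ p → F (suc p)))

block-mul : ∀ N P Q i j → (block N P ⊗ block N Q) i j ≡ mul N P Q (suc (toℕ i)) (suc (toℕ j))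
block-mul N P Q i j = sumFin-∑ N (λ l → P (suc (toℕ i)) l * Q l (suc (toℕ j)))

block-inverse : ∀ N {A B} → mul N B A ≈[ N ] δ → mul N A B ≈[ N ] δ → IsInverse (block N A) (block N B)
block-inverse N {A} {B} BA≈1 AB≈1 =
  (λ i j → trans (block-mul N A B i j) (entry AB≈1 (toℕ i) (toℕ j) (toℕ<n i) (toℕ<n j))) ,
  (λ i j → trans (block-mul N B A i j) (entry BA≈1 (toℕ i) (toℕ j) (toℕ<n i) (toℕ<n j)))

block-S : ∀ N B → S (block N B) ≡ ∑ N (λ p → ∑ N (B p))
block-S N B = trans (sumFin-∑ N (λ p → sumFin N (λ j → B p (suc (toℕ j))))) (∑-ext N (λ p → sumFin-∑ N (B p)))

inverse-of : ∀ N {C A T Y} → C ≈[ N ] A → mul N W A ≈[ N ] T → mul N Y T ≈[ N ] δ → mul N T Y ≈[ N ] δ →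
  IsInverse (block N C) (block N (mul N Y W))
inverse-of N {C} {A} {T} {Y} C≈A WA≈T YT≈1 TY≈1 = block-inverse N {C} {mul N Y W} (proj₁ inv) (proj₂ inv)
  where inv : mul N (mul N Y W) C ≈[ N ] δ × mul N C (mul N Y W) ≈[ N ] δ
        inv = inverse-via N {C} {W} {T} {Y} {V} (≈-trans (mul-congʳ N W C≈A) WA≈T) YT≈1 TY≈1 (V·W N)

∑-δ-col : ∀ N k → k < N → ∑ N (λ p → δ p (suc k)) ≡ + 1
∑-δ-col N k k<N = trans (∑-ext N (λ p → δ-sym p (suc k))) (∑-δ-in N k k<N)

module Sums (M : ℕ) where
  N : ℕ
  N = suc (suc (suc (suc (suc M))))

  F : ℤ
  F = + fib (suc (suc (suc (suc M))))

  -- the last two columns of X₁ are column N - 1 of X and e_N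
  S-X₁W : S (block N (mul N (X₁ N) W)) ≡ + 2 + sgn M * F
  S-X₁W = begin
    S (block N (mul N (X₁ N) W))
      ≡⟨ block-S N (mul N (X₁ N) W) ⟩
    ∑ N (λ p → ∑ N (mul N (X₁ N) W p))
      ≡⟨ ∑∑-·W (suc (suc M)) (X₁ N) ⟩
    ∑ N (λ p → X₁ N p (N ∸ 1)) + ∑ N (λ p → X₁ N p N)
      ≡⟨ cong₂ _+_ (∑-ext N (λ p → unitFrom-< N X p (N ∸ 1) (ℕP.n<1+n _))) (∑-ext N (λ p → unitFrom-≥ N X p N ℕP.≤-refl)) ⟩
    ∑ N (λ p → X p (N ∸ 1)) + ∑ N (λ p → δ p N)
      ≡⟨ cong₂ _+_ (colsum-X N (suc (suc M)) (ℕP.n≤1+n _)) (∑-δ-col N (suc (suc (suc (suc M)))) (ℕP.n<1+n _)) ⟩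
    + 1 + - - sgn M * F + + 1
      ≡⟨ collect (sgn M) F ⟩
    + 2 + sgn M * F ∎
    where
    open ≡-Reasoning
    collect : ∀ s f → + 1 + - - s * f + + 1 ≡ + 2 + s * f
    collect = solve-∀

  -- The last two columns of X₂ are e_{N-1} and e_N + X (e_{N-2} - e_{N-3}).
  S-X₂W : S (block N (mul N (X₂ N) W)) ≡ + 2 - sgn M * F
  S-X₂W = begin
    S (block N (mul N (X₂ N) W))
      ≡⟨ block-S N (mul N (X₂ N) W) ⟩
    ∑ N (λ p → ∑ N (mul N (X₂ N) W p))
      ≡⟨ ∑∑-·W (suc (suc M)) (X₂ N) ⟩
    ∑ N (λ p → X₂ N p (N ∸ 1)) + ∑ N (λ p → X₂ N p N)
      ≡⟨ cong₂ _+_ (trans (∑-ext N column-N-1) (∑-δ-col N (suc (suc (suc M))) (ℕP.≤-trans (ℕP.n<1+n _) (ℕP.n≤1+n _))))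
                   (trans (∑-ext N column-N) (∑-+ N (λ p → δ p N) (λ p → X p (N ∸ 2) - X p (N ∸ 3)))) ⟩
    + 1 + (∑ N (λ p → δ p N) + ∑ N (λ p → X p (N ∸ 2) - X p (N ∸ 3)))
      ≡⟨ cong₂ (λ a b → + 1 + (a + b)) (∑-δ-col N (suc (suc (suc (suc M)))) (ℕP.n<1+n _))
               (trans (∑-- N (λ p → X p (N ∸ 2)) (λ p → X p (N ∸ 3)))
                      (cong₂ _-_ (colsum-X N (suc M) (ℕP.m≤n+m _ 2)) (colsum-X N M (ℕP.m≤n+m _ 3)))) ⟩
    + 1 + (+ 1 + ((+ 1 + - sgn M * + fib (suc (suc (suc M)))) - (+ 1 + sgn M * + fib (suc (suc M)))))
      ≡⟨ collect (sgn M) (+ fib (suc (suc (suc M)))) (+ fib (suc (suc M))) ⟩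
    + 2 - sgn M * (+ fib (suc (suc (suc M))) + + fib (suc (suc M)))
      ≡⟨ cong (λ f → + 2 - sgn M * f) (sym (pos-+ (fib (suc (suc (suc M)))) (fib (suc (suc M))))) ⟩
    + 2 - sgn M * F ∎
    where
    open ≡-Reasoning
    X′ : Matℕ
    X′ = unitFrom (N ∸ 1) X
    collect : ∀ s a b → + 1 + (+ 1 + ((+ 1 + - s * a) - (+ 1 + s * b))) ≡ + 2 - s * (a + b)
    collect = solve-∀
    column-N-1 : ∀ p → X₂ N p (N ∸ 1) ≡ δ p (N ∸ 1)
    column-N-1 p = begin
      X′ p (N ∸ 1) + δ N (N ∸ 1) * apply N X′ (shift N) p ≡⟨ cong (λ d → X′ p (N ∸ 1) + d * apply N X′ (shift N) p) (δ-off {N} {N ∸ 1} (ℕP.>⇒≢ (ℕP.n<1+n _))) ⟩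
      X′ p (N ∸ 1) + + 0                                  ≡⟨ +-identityʳ _ ⟩
      X′ p (N ∸ 1)                                        ≡⟨ unitFrom-≥ (N ∸ 1) X p (N ∸ 1) ℕP.≤-refl ⟩
      δ p (N ∸ 1)                                         ∎
    -- sifting the shear vector picks out the columns N - 2 and N - 3, untouched in X′
    apply-shift : ∀ p → apply N X′ (shift N) p ≡ X p (N ∸ 2) - X p (N ∸ 3)
    apply-shift p = begin
      ∑ N (λ l → X′ p l * (δ (N ∸ 2) l - δ (N ∸ 3) l))
        ≡⟨ ∑-ext N (λ l → spread (X′ p l) (δ (N ∸ 2) l) (δ (N ∸ 3) l)) ⟩
      ∑ N (λ l → (δ (N ∸ 2) l + - + 1 * δ (N ∸ 3) l + + 0 * δ (N ∸ 3) l) * X′ p l)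
        ≡⟨ sift₃ N (- + 1) (+ 0) {N ∸ 2} {N ∸ 3} {N ∸ 3} (X′ p) (sift-in N (suc (suc M)) (X′ p) (ℕP.m≤n+m _ 2))
                 (sift-in N (suc M) (X′ p) (ℕP.m≤n+m _ 3)) (sift-in N (suc M) (X′ p) (ℕP.m≤n+m _ 3)) ⟩
      X′ p (N ∸ 2) + - + 1 * X′ p (N ∸ 3) + + 0 * X′ p (N ∸ 3)
        ≡⟨ cong₂ (λ a b → a + - + 1 * b + + 0 * b) (unitFrom-< (N ∸ 1) X p (N ∸ 2) (ℕP.n<1+n _))
                 (unitFrom-< (N ∸ 1) X p (N ∸ 3) (ℕP.m≤n+m _ 1)) ⟩
      X p (N ∸ 2) + - + 1 * X p (N ∸ 3) + + 0 * X p (N ∸ 3)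
        ≡⟨ tidy (X p (N ∸ 2)) (X p (N ∸ 3)) ⟩
      X p (N ∸ 2) - X p (N ∸ 3) ∎
      where
      spread : ∀ x a b → x * (a - b) ≡ (a + - + 1 * b + + 0 * b) * x
      spread = solve-∀
      tidy : ∀ a b → a + - + 1 * b + + 0 * b ≡ a - b
      tidy = solve-∀
    column-N : ∀ p → X₂ N p N ≡ δ p N + (X p (N ∸ 2) - X p (N ∸ 3))
    column-N p = cong₂ _+_ (unitFrom-≥ (N ∸ 1) X p N (ℕP.n≤1+n _))
                           (trans (cong (_* apply N X′ (shift N) p) (cong b2z (≡ᵇ-true {N} refl)))
                                  (trans (*-identityˡ _) (apply-shift p)))

sgn-even : ∀ m → odd m ≡ false → ∀ f → sgn m * f ≡ f
sgn-even zero          _    f = *-identityˡ f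
sgn-even (suc (suc m)) even f = trans (cong (_* f) (neg-involutive (sgn m))) (sgn-even m even f)

sgn-odd : ∀ m → odd m ≡ true → ∀ f → sgn m * f ≡ - f
sgn-odd (suc zero)    _   f = -1*i≡-i f
sgn-odd (suc (suc m)) odd f = trans (cong (_* f) (neg-involutive (sgn m))) (sgn-odd m odd f)

even-odd : ∀ n → n % 2 ≡ 0 → odd n ≡ false
even-odd n n%2≡0 = not-true (trans (sym (isEven-odd n)) (cong (_≡ᵇ 0) n%2≡0))
  where not-true : ∀ {b} → not b ≡ true → b ≡ false
        not-true {false} _ = refl

odd-odd : ∀ n → n % 2 ≡ 1 → odd n ≡ true
odd-odd n n%2≡1 = trans (sym (mod2-odd n)) (cong (_≡ᵇ 1) n%2≡1)

-- n = M + 6 with M even (so N = n - 1 is odd): C₁ = A₁ 0 and C₃ = A₂ 1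
even-case : ∀ M → odd M ≡ false → let n = suc (suc (suc (suc (suc (suc M))))) in
    Σ (Mat (n ∸ 1)) (λ B → IsInverse (C₁ n) B × S B ≡ + 2 + + fib (n ∸ 2))
  × Σ (Mat (n ∸ 1)) (λ B → IsInverse (C₃ n) B × S B ≡ + 2 - + fib (n ∸ 2))
even-case M even =
    (block N (mul N (X₁ N) W) , inverse₁ , trans S-X₁W (cong (_+_ (+ 2)) (sgn-even M even F)))
  , (block N (mul N (X₂ N) W) , inverse₃ , trans S-X₂W (cong (_-_ (+ 2)) (sgn-even M even F)))
  where
  open Models M
  open Sums M hiding (N)
  odd-N : odd N ≡ true
  odd-N = trans (odd-suc M) (cong not even)
  inverse₁ : IsInverse (block N (asℕ c1 (suc N))) (block N (mul N (X₁ N) W))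
  inverse₁ = inverse-of N {asℕ c1 (suc N)} {A₁ (+ 0) N} {T₁ N} {X₁ N} (C₁≈A₁ odd-N)
               (W·A₁ (+ 0) N (cong (λ b → b2z (not b)) (sym odd-N)) (s≤s (s≤s z≤n))) (X₁·T₁ N) (T₁·X₁ N)
  inverse₃ : IsInverse (block N (asℕ c3 (suc N))) (block N (mul N (X₂ N) W))
  inverse₃ = inverse-of N {asℕ c3 (suc N)} {A₂ (+ 1) N} {T₂ N} {X₂ N} (C₃≈A₂ odd-N)
               (W·A₂ (+ 1) M (cong (λ b → b2z (not b)) (sym even))) (proj₁ (X₂·T₂×T₂·X₂ M)) (proj₂ (X₂·T₂×T₂·X₂ M))

-- n = M + 6 with M odd (so N = n - 1 is even): C₂ = A₂ 0 and C₄ = A₁ 1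
odd-case : ∀ M → odd M ≡ true → let n = suc (suc (suc (suc (suc (suc M))))) in
    Σ (Mat (n ∸ 1)) (λ B → IsInverse (C₂ n) B × S B ≡ + 2 + + fib (n ∸ 2))
  × Σ (Mat (n ∸ 1)) (λ B → IsInverse (C₄ n) B × S B ≡ + 2 - + fib (n ∸ 2))
odd-case M odd-M =
    (block N (mul N (X₂ N) W) , inverse₂ , trans S-X₂W (trans (cong (_-_ (+ 2)) (sgn-odd M odd-M F)) (cong (_+_ (+ 2)) (neg-involutive F))))
  , (block N (mul N (X₁ N) W) , inverse₄ , trans S-X₁W (cong (_+_ (+ 2)) (sgn-odd M odd-M F)))
  where
  open Models M
  open Sums M hiding (N)
  odd-N : odd N ≡ false
  odd-N = trans (odd-suc M) (cong not odd-M)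
  inverse₂ : IsInverse (block N (asℕ c2 (suc N))) (block N (mul N (X₂ N) W))
  inverse₂ = inverse-of N {asℕ c2 (suc N)} {A₂ (+ 0) N} {T₂ N} {X₂ N} (C₂≈A₂ odd-N)
               (W·A₂ (+ 0) M (cong (λ b → b2z (not b)) (sym odd-M))) (proj₁ (X₂·T₂×T₂·X₂ M)) (proj₂ (X₂·T₂×T₂·X₂ M))
  inverse₄ : IsInverse (block N (asℕ c4 (suc N))) (block N (mul N (X₁ N) W))
  inverse₄ = inverse-of N {asℕ c4 (suc N)} {A₁ (+ 1) N} {T₁ N} {X₁ N} (C₄≈A₁ odd-N)
               (W·A₁ (+ 1) N (cong (λ b → b2z (not b)) (sym odd-N)) (s≤s (s≤s z≤n))) (X₁·T₁ N) (T₁·X₁ N)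

lemma2p7 : ((n : ℕ) → 6 ≤ n → n % 2 ≡ 0 →
               Σ (Mat (n ∸ 1)) (λ B → IsInverse (C₁ n) B × S B ≡ + 2 + + fib (n ∸ 2))
               × Σ (Mat (n ∸ 1)) (λ B → IsInverse (C₃ n) B × S B ≡ + 2 - + fib (n ∸ 2)))
             × ((n : ℕ) → 7 ≤ n → n % 2 ≡ 1 →
               Σ (Mat (n ∸ 1)) (λ B → IsInverse (C₂ n) B × S B ≡ + 2 + + fib (n ∸ 2))
               × Σ (Mat (n ∸ 1)) (λ B → IsInverse (C₄ n) B × S B ≡ + 2 - + fib (n ∸ 2)))
lemma2p7 =
    (λ { .(suc (suc (suc (suc (suc (suc M)))))) (s≤s (s≤s (s≤s (s≤s (s≤s (s≤s {n = M} _)))))) n%2≡0 →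
           even-case M (even-odd (suc (suc (suc (suc (suc (suc M)))))) n%2≡0) })
  , (λ { .(suc (suc (suc (suc (suc (suc (suc M))))))) (s≤s (s≤s (s≤s (s≤s (s≤s (s≤s (s≤s {n = M} _))))))) n%2≡1 →
           odd-case (suc M) (odd-odd (suc (suc (suc (suc (suc (suc (suc M))))))) n%2≡1) })
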